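{- Let $P(X)=\sum_{i=0}^{m} A_i X^i$ be a polynomial whose coefficients $A_0,\dots,A_m$ are finite discrete dynamical systems (FDDSs). Then $P$ is injective on FDDSs (i.e., for all FDDSs $X,Y$, $P(X)=P(Y)$ implies $X=Y$) if and only if at least one coefficient $A_i$ with $i>0$ contains a dendron as a connected component.
   Context: An FDDS is a pair $(A,f_A)$ with $A$ a finite set of states and $f_A\colon A\to A$ a total function, viewed as a functional digraph and considered up to isomorphism. The sum of two FDDSs is their disjoint union and the product is the direct (tensor) product of digraphs: vertex set $V(A)\times V(B)$ and an arc $(u,u')\to(v,v')$ iff $u\to v$ in $A$ and $u'\to v'$ in $B$. These operations make FDDSs a commutative semiring, with $\mathbf{0}$ the empty FDDS and $\mathbf{1}$ the single fixed point; $X^0=\mathbf{1}$. Every connected component of an FDDS consists of one cycle with in-trees rooted on it. A dendron is a connected FDDS whose cycle has length $1$. An FDDS $A$ "contains" a connected FDDS $D$ if $D$ is one of its connected components. -}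

module Defs where

open import Data.Nat using (ℕ; zero; suc; _+_; _*_; _>_)
open import Data.Fin using (Fin; toℕ; splitAt; join; combine; remQuot)
open import Data.Sum using (_⊎_)
import Data.Sum as Sum
open import Data.Product using (Σ; ∃; _×_; _,_; uncurry)
import Data.Product as Prod
open import Data.Vec using (Vec; []; _∷_; lookup)
open import Relation.Binary.PropositionalEquality using (_≡_)
open import Relation.Binary.Construct.Closure.Equivalence using (EqClosure)

record FDDS : Set where
  constructor fdds
  field
    size : ℕ
    step : Fin size → Fin size
open FDDS public

record _≅_ (A B : FDDS) : Set where
  field
    to      : Fin (size A) → Fin (size B)
    from    : Fin (size B) → Fin (size A)
    from-to : ∀ x → from (to x) ≡ x
    to-from : ∀ y → to (from y) ≡ y
    commute : ∀ x → to (step A x) ≡ step B (to x)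
infix 4 _≅_

𝟘 : FDDS
𝟘 = fdds 0 (λ ())

𝟙 : FDDS
𝟙 = fdds 1 (λ x → x)

_⊕_ : FDDS → FDDS → FDDS
A ⊕ B = fdds (size A + size B)
  (λ x → join (size A) (size B) (Sum.map (step A) (step B) (splitAt (size A) x)))
infixl 6 _⊕_

_⊗_ : FDDS → FDDS → FDDS
A ⊗ B = fdds (size A * size B)
  (λ x → uncurry combine (Prod.map (step A) (step B) (remQuot (size B) x)))
infixl 7 _⊗_

_^_ : FDDS → ℕ → FDDS
X ^ zero = 𝟙
X ^ suc k = X ⊗ (X ^ k)

evalFrom : ∀ {k} → ℕ → Vec FDDS k → FDDS → FDDS
evalFrom i [] X = 𝟘
evalFrom i (A ∷ As) X = (A ⊗ (X ^ i)) ⊕ evalFrom (suc i) As X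

eval : ∀ {k} → Vec FDDS k → FDDS → FDDS
eval As X = evalFrom 0 As X

Arc : (A : FDDS) → Fin (size A) → Fin (size A) → Set
Arc A x y = step A x ≡ y

Connected : FDDS → Set
Connected A = (size A > 0) × (∀ x y → EqClosure (Arc A) x y)

-- Dendron: connected FDDS whose (unique) cycle has length 1, i.e. the cycle is a fixed point.
Dendron : FDDS → Set
Dendron D = Connected D × ∃ λ x → step D x ≡ x

ContainsDendron : FDDS → Set
ContainsDendron A = Σ FDDS λ D → Σ FDDS λ B → Dendron D × (A ≅ D ⊕ B)

Injective : ∀ {k} → Vec FDDS k → Set
Injective As = ∀ X Y → eval As X ≅ eval As Y → X ≅ Y

-- For a connected FDDS C, the number of homomorphisms C → Z is additive in Z over
-- sums and multiplicative over products, so homCount C (P X) is the ℕ-polynomial with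
-- coefficients homCount C Aᵢ evaluated at homCount C X.  Lovász's counting argument
-- shows that two FDDSs with the same hom counts from every connected C are isomorphic.
-- A dendron in some Aᵢ with i > 0 gives Aᵢ a fixed point, hence homCount C Aᵢ ≥ 1 for
-- every C, and then the polynomial is strictly increasing: P X ≅ P Y forces X ≅ Y.
-- Conversely, if no Aᵢ with i > 0 has a fixed point, every connected C mapping into
-- some Aᵢ maps onto a cycle of some length between 2 and N = Σ size Aᵢ.  The
-- systems X[ N ] and Y[ N ] built from 𝟙, 𝟘 and cycles have equal hom counts from all
-- such C, and from any other C the polynomial is the constant homCount C A₀; so
-- P X[ N ] ≅ P Y[ N ], although only X[ N ] has a fixed point.

module Submission where

open import Defs
open import Data.Nat using (ℕ; suc; _>_)
open import Data.Fin using (Fin; toℕ)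
open import Data.Vec using (Vec; lookup)
open import Data.Product using (Σ; _×_)
open import Function.Bundles using (_⇔_)

open import Data.Nat as ℕ using (zero; _+_; _*_; _∸_; _≤_; _<_; z≤n; s≤s)
import Data.Nat.Properties as ℕP
open import Data.Nat.DivMod using (_%_; _/_; _mod_; m%n<n; m≡m%n+[m/n]*n; %-distribˡ-+; m%n%n≡m%n; m<n⇒m%n≡m; [m+n]%n≡m%n; n%n≡0)
open import Data.Fin as F using (zero; suc; _↑ˡ_; _↑ʳ_)
import Data.Fin.Properties as FP
open import Data.Fin.Permutation using (↔⇒≡)
open import Relation.Binary.Construct.Closure.Equivalence as EC using (EqClosure)
open import Data.Bool using (Bool; true; false; T; _∧_; not)
import Data.Bool.Properties as BP
open import Data.Sum using (_⊎_; inj₁; inj₂; [_,_]′)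
import Data.Sum as Sum
open import Data.Sum.Properties using (inj₁-injective; inj₂-injective)
open import Data.Sum.Algebra using (⊎-cong)
open import Data.Product using (∃; _,_; proj₁; proj₂; uncurry)
import Data.Product as Prod
open import Data.Product.Algebra using (×-cong)
open import Data.Unit using (tt)
open import Data.Empty using (⊥; ⊥-elim)
open import Data.Vec as V using ([]; _∷_; tabulate)
open import Data.Fin.Subset using (Subset; _∈_; _⊆_; _⊂_)
import Data.Fin.Subset.Properties as SubsetP
import Data.Vec.Properties as VP
open import Relation.Nullary using (¬_; ¬?; yes; no)
open import Relation.Binary.Definitions using (DecidableEquality; tri<; tri≈; tri>)
open import Relation.Nullary.Decidable using (⌊_⌋; isYes≗does; dec-true; dec-false; toWitness; fromWitness; decidable-stable; _→-dec_)
open import Induction.WellFounded using (module All)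
import Data.Fin.Subset.Induction as SubsetI
open import Level using (0ℓ)
open import Relation.Binary.PropositionalEquality
open import Function using (_∘_; _$_)
open import Function.Bundles using (_↔_; Inverse; Equivalence; mk↔ₛ′; mk⇔)
open import Function.Properties.Inverse using (↔-refl; ↔-sym; ↔-trans)
open import Algebra.Properties.CommutativeMonoid.Sum ℕP.+-0-commutativeMonoid
  using (sum; sum-cong-≗; sum-remove; ∑-comm)


-- Counting

Bool→ℕ : Bool → ℕ
Bool→ℕ true  = 1
Bool→ℕ false = 0

T↔Fin : ∀ b → T b ↔ Fin (Bool→ℕ b)
T↔Fin true  = ↔-sym FP.1↔⊤
T↔Fin false = ↔-sym FP.0↔⊥

Σ-Fin-suc↔ : ∀ {n} (P : Fin (suc n) → Set) → Σ (Fin (suc n)) P ↔ (P zero ⊎ Σ (Fin n) (P ∘ suc))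
Σ-Fin-suc↔ P = mk↔ₛ′ split join (λ { (inj₁ _) → refl ; (inj₂ _) → refl }) (λ { (zero , _) → refl ; (suc _ , _) → refl })
  where
  split : Σ _ P → P zero ⊎ Σ _ (P ∘ suc)
  split (zero  , x) = inj₁ x
  split (suc i , x) = inj₂ (i , x)
  join : P zero ⊎ Σ _ (P ∘ suc) → Σ _ P
  join (inj₁ x)       = zero , x
  join (inj₂ (i , x)) = suc i , x

count : ∀ {n} → (Fin n → Bool) → ℕ
count p = sum (Bool→ℕ ∘ p)

count-↔ : ∀ {n} (p : Fin n → Bool) → Σ (Fin n) (T ∘ p) ↔ Fin (count p)
count-↔ {zero}  p = mk↔ₛ′ (λ { (() , _) }) (λ ()) (λ ()) (λ { (() , _) })
count-↔ {suc n} p = ↔-trans (Σ-Fin-suc↔ (T ∘ p))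
  (↔-trans (⊎-cong (T↔Fin (p zero)) (count-↔ (p ∘ suc))) (↔-sym FP.+↔⊎))

count-cong : ∀ {n} {p q : Fin n → Bool} → (∀ i → p i ≡ q i) → count p ≡ count q
count-cong p≗q = sum-cong-≗ (cong Bool→ℕ ∘ p≗q)

count>0⇒∃ : ∀ {n} (p : Fin n → Bool) → 0 < count p → ∃ (T ∘ p)
count>0⇒∃ p pos = Inverse.from (count-↔ p) (F.fromℕ< pos)

∃⇒count>0 : ∀ {n} (p : Fin n → Bool) {i} → T (p i) → 0 < count p
∃⇒count>0 p {i} pi = ℕP.≤-<-trans z≤n (FP.toℕ<n (Inverse.to (count-↔ p) (i , pi)))

count≡0 : ∀ {n} {p : Fin n → Bool} → (∀ i → p i ≡ false) → count p ≡ 0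
count≡0 {zero}  p≗false = refl
count≡0 {suc n} p≗false rewrite p≗false zero = count≡0 (p≗false ∘ suc)

count-∧ˡ : ∀ {n} c (q : Fin n → Bool) → count (λ i → c ∧ q i) ≡ Bool→ℕ c * count q
count-∧ˡ     true  q = sym (ℕP.+-identityʳ _)
count-∧ˡ {n} false q = count≡0 {n} {λ _ → false} (λ _ → refl)

≤-sum : ∀ {n} (f : Fin n → ℕ) i → f i ≤ sum f
≤-sum {suc n} f i = ℕP.≤-trans (ℕP.m≤m+n (f i) _) (ℕP.≤-reflexive (sym (sum-remove {i = i} f)))

sum-cancel-except : ∀ {n} (f g : Fin n → ℕ) i → sum f ≡ sum g → (∀ j → j ≢ i → f j ≡ g j) → f i ≡ g i
sum-cancel-except {suc n} f g i Σf≡Σg f≗g = ℕP.+-cancelʳ-≡ _ (f i) (g i) $ begin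
  f i + sum (f ∘ F.punchIn i) ≡⟨ sym (sum-remove {i = i} f) ⟩
  sum f                       ≡⟨ Σf≡Σg ⟩
  sum g                       ≡⟨ sum-remove {i = i} g ⟩
  g i + sum (g ∘ F.punchIn i) ≡⟨ cong (g i +_) (sum-cong-≗ (λ j → sym (f≗g _ (FP.punchInᵢ≢i i j)))) ⟩
  g i + sum (f ∘ F.punchIn i) ∎
  where open ≡-Reasoning

_≡ᵇ_ : ∀ {n} → Fin n → Fin n → Bool
i ≡ᵇ j = ⌊ i FP.≟ j ⌋

≡ᵇ-refl : ∀ {n} (i : Fin n) → (i ≡ᵇ i) ≡ true
≡ᵇ-refl i = trans (isYes≗does (i FP.≟ i)) (dec-true (i FP.≟ i) refl)

≢⇒≡ᵇ-false : ∀ {n} {i j : Fin n} → i ≢ j → (i ≡ᵇ j) ≡ false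
≢⇒≡ᵇ-false {i = i} {j} i≢j = trans (isYes≗does (i FP.≟ j)) (dec-false (i FP.≟ j) i≢j)

T-⇔⇒≡ : ∀ {a b} → (T a → T b) → (T b → T a) → a ≡ b
T-⇔⇒≡ {false} {false} _ _ = refl
T-⇔⇒≡ {false} {true}  _ g = ⊥-elim (g tt)
T-⇔⇒≡ {true}  {false} f _ = ⊥-elim (f tt)
T-⇔⇒≡ {true}  {true}  _ _ = refl

sum-≡ᵇ : ∀ {n} (i : Fin n) → sum (λ j → Bool→ℕ (i ≡ᵇ j)) ≡ 1
sum-≡ᵇ {suc n} i = begin
  sum (λ j → Bool→ℕ (i ≡ᵇ j))                   ≡⟨ sum-remove {i = i} (λ j → Bool→ℕ (i ≡ᵇ j)) ⟩
  Bool→ℕ (i ≡ᵇ i) + sum (λ j → Bool→ℕ (i ≡ᵇ F.punchIn i j))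
    ≡⟨ cong₂ (λ b s → Bool→ℕ b + s) (≡ᵇ-refl i) (count≡0 (λ j → ≢⇒≡ᵇ-false (FP.punchInᵢ≢i i j ∘ sym))) ⟩
  1 ∎
  where open ≡-Reasoning

count-fibres : ∀ {n m} (p : Fin n → Bool) (key : Fin n → Fin m) →
  count p ≡ sum (λ b → count (λ a → p a ∧ (key a ≡ᵇ b)))
count-fibres {n} {m} p key = begin
  sum (λ a → Bool→ℕ (p a))                           ≡⟨ sum-cong-≗ (λ a → sym (sum-∧ (p a) (key a))) ⟩
  sum (λ a → sum (λ b → Bool→ℕ (p a ∧ (key a ≡ᵇ b)))) ≡⟨ ∑-comm (λ a b → Bool→ℕ (p a ∧ (key a ≡ᵇ b))) ⟩
  sum (λ b → count (λ a → p a ∧ (key a ≡ᵇ b)))         ∎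
  where
  open ≡-Reasoning
  sum-∧ : ∀ c (k : Fin m) → sum (λ b → Bool→ℕ (c ∧ (k ≡ᵇ b))) ≡ Bool→ℕ c
  sum-∧ true  k = sum-≡ᵇ k
  sum-∧ false k = count≡0 {m} {λ _ → false} (λ _ → refl)

Σ-T-≡ : ∀ {A : Set} {p : A → Bool} {a a′} {pa : T (p a)} {pa′ : T (p a′)} → a ≡ a′ → (a , pa) ≡ (a′ , pa′)
Σ-T-≡ refl = cong (_ ,_) (BP.T-irrelevant _ _)

restrict-↔ : ∀ {A B : Set} {p : A → Bool} {q : B → Bool} (f : A → B) (g : B → A) →
  (∀ a → T (p a) → T (q (f a))) → (∀ b → T (q b) → T (p (g b))) →
  (∀ a → T (p a) → g (f a) ≡ a) → (∀ b → T (q b) → f (g b) ≡ b) →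
  Σ A (T ∘ p) ↔ Σ B (T ∘ q)
restrict-↔ f g fq gp gf fg = mk↔ₛ′
  (λ (a , pa) → f a , fq a pa) (λ (b , qb) → g b , gp b qb)
  (λ (b , qb) → Σ-T-≡ (fg b qb)) (λ (a , pa) → Σ-T-≡ (gf a pa))

countBy : ∀ {A : Set} {n} → A ↔ Fin n → (A → Bool) → ℕ
countBy A↔ p = count (p ∘ Inverse.from A↔)

countBy-↔ : ∀ {A : Set} {n} (A↔ : A ↔ Fin n) (p : A → Bool) → Σ A (T ∘ p) ↔ Fin (countBy A↔ p)
countBy-↔ A↔ p = ↔-trans
  (restrict-↔ (Inverse.to A↔) (Inverse.from A↔) (λ a → subst (T ∘ p) (sym (Inverse.strictlyInverseʳ A↔ a))) (λ _ pa → pa)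
    (λ a _ → Inverse.strictlyInverseʳ A↔ a) (λ i _ → Inverse.strictlyInverseˡ A↔ i))
  (count-↔ (p ∘ Inverse.from A↔))

Vec↔ : ∀ {A : Set} {k} → A ↔ Fin k → ∀ n → Vec A n ↔ Fin (k ℕ.^ n)
Vec↔ A↔ zero    = mk↔ₛ′ (λ _ → zero) (λ _ → []) (λ { zero → refl }) (λ { [] → refl })
Vec↔ A↔ (suc n) = ↔-trans ∷↔× (↔-trans (×-cong A↔ (Vec↔ A↔ n)) (↔-sym FP.*↔×))
  where
  ∷↔× : Vec _ (suc n) ↔ (_ × Vec _ n)
  ∷↔× = mk↔ₛ′ (λ { (x ∷ xs) → x , xs }) (λ (x , xs) → x ∷ xs) (λ _ → refl) (λ { (x ∷ xs) → refl })

-- Homomorphisms and hom counts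

≅-sym : ∀ {A B} → A ≅ B → B ≅ A
≅-sym {A} {B} A≅B = record { to = from ; from = to ; from-to = to-from ; to-from = from-to ; commute = from-commute }
  where
  open _≅_ A≅B
  from-commute : ∀ y → from (step B y) ≡ step A (from y)
  from-commute y = begin
    from (step B y)             ≡⟨ cong (from ∘ step B) (sym (to-from y)) ⟩
    from (step B (to (from y))) ≡⟨ cong from (sym (commute (from y))) ⟩
    from (to (step A (from y))) ≡⟨ from-to _ ⟩
    step A (from y)             ∎
    where open ≡-Reasoning

≅-trans : ∀ {A B C} → A ≅ B → B ≅ C → A ≅ C
≅-trans A≅B B≅C = record
  { to      = E.to ∘ D.to
  ; from    = D.from ∘ E.from
  ; from-to = λ x → trans (cong D.from (E.from-to (D.to x))) (D.from-to x)
  ; to-from = λ z → trans (cong E.to (D.to-from (E.from z))) (E.to-from z)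
  ; commute = λ x → trans (cong E.to (D.commute x)) (E.commute (D.to x))
  }
  where module D = _≅_ A≅B
        module E = _≅_ B≅C

≅⇒size≡ : ∀ {A B} → A ≅ B → size A ≡ size B
≅⇒size≡ A≅B = ↔⇒≡ (mk↔ₛ′ to from to-from from-to)
  where open _≅_ A≅B

-- Maps are tabulated as vectors, so that the maps G → Z form a finite set that can be
-- counted without function extensionality.
Map : FDDS → FDDS → Set
Map G Z = Vec (Fin (size Z)) (size G)

record IsHomFn (G Z : FDDS) (f : Fin (size G) → Fin (size Z)) : Set where
  constructor homFn
  field commutes : ∀ i → f (step G i) ≡ step Z (f i)
open IsHomFn public

IsHom : (G Z : FDDS) → Map G Z → Set
IsHom G Z v = IsHomFn G Z (lookup v)

opaque
  isHom : (G Z : FDDS) → Map G Z → Bool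
  isHom G Z v = ⌊ FP.all? (λ i → lookup v (step G i) FP.≟ step Z (lookup v i)) ⌋

  toHom : ∀ {G Z} v → IsHom G Z v → T (isHom G Z v)
  toHom v h = fromWitness (commutes h)

  fromHom : ∀ {G Z} v → T (isHom G Z v) → IsHom G Z v
  fromHom v h = homFn (toWitness h)

Hom : FDDS → FDDS → Set
Hom G Z = Σ (Map G Z) (T ∘ isHom G Z)

Map↔ : ∀ G Z → Map G Z ↔ Fin (size Z ℕ.^ size G)
Map↔ G Z = Vec↔ ↔-refl (size G)

opaque
  homCount : FDDS → FDDS → ℕ
  homCount G Z = countBy (Map↔ G Z) (isHom G Z)

  Hom↔ : ∀ G Z → Hom G Z ↔ Fin (homCount G Z)
  Hom↔ G Z = countBy-↔ (Map↔ G Z) (isHom G Z)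

homCount-unique : ∀ G Z {k} → Hom G Z ↔ Fin k → homCount G Z ≡ k
homCount-unique G Z H↔ = ↔⇒≡ (↔-trans (↔-sym (Hom↔ G Z)) H↔)

Hom-↔ : ∀ G Z G′ Z′ (Φ : Map G Z → Map G′ Z′) (Ψ : Map G′ Z′ → Map G Z) →
  (∀ v → IsHom G Z v → IsHom G′ Z′ (Φ v)) → (∀ w → IsHom G′ Z′ w → IsHom G Z (Ψ w)) →
  (∀ v → IsHom G Z v → Ψ (Φ v) ≡ v) → (∀ w → IsHom G′ Z′ w → Φ (Ψ w) ≡ w) →
  Hom G Z ↔ Hom G′ Z′
Hom-↔ G Z G′ Z′ Φ Ψ Φ-hom Ψ-hom ΨΦ ΦΨ = restrict-↔ Φ Ψ
  (λ v → toHom (Φ v) ∘ Φ-hom v ∘ fromHom v) (λ w → toHom (Ψ w) ∘ Ψ-hom w ∘ fromHom w)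
  (λ v → ΨΦ v ∘ fromHom v) (λ w → ΦΨ w ∘ fromHom w)

≗⇒≡ : ∀ {A : Set} {n} {u v : Vec A n} → (∀ i → lookup u i ≡ lookup v i) → u ≡ v
≗⇒≡ {u = u} {v} u≗v = trans (sym (VP.tabulate∘lookup u)) (trans (VP.tabulate-cong u≗v) (VP.tabulate∘lookup v))

tabulate-hom : ∀ {G Z f} → IsHomFn G Z f → IsHom G Z (tabulate f)
tabulate-hom {G} {Z} {f} f-hom = homFn λ i → begin
  lookup (tabulate f) (step G i) ≡⟨ VP.lookup∘tabulate f (step G i) ⟩
  f (step G i)                   ≡⟨ commutes f-hom i ⟩
  step Z (f i)                   ≡⟨ cong (step Z) (sym (VP.lookup∘tabulate f i)) ⟩
  step Z (lookup (tabulate f) i) ∎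
  where open ≡-Reasoning

_∘ᵛ_ : ∀ {A : Set} {m n} → Vec A m → (Fin n → Fin m) → Vec A n
v ∘ᵛ f = tabulate (lookup v ∘ f)

∘ᵛ-hom : ∀ {H G Z f} v → IsHom G Z v → IsHomFn H G f → IsHom H Z (v ∘ᵛ f)
∘ᵛ-hom {f = f} v v-hom f-hom = tabulate-hom (homFn λ i → trans (cong (lookup v) (commutes f-hom i)) (commutes v-hom (f i)))

map-hom : ∀ {G Z Z′ f} v → IsHom G Z v → IsHomFn Z Z′ f → IsHom G Z′ (V.map f v)
map-hom {G} {Z} {Z′} {f} v v-hom f-hom = homFn λ i → begin
  lookup (V.map f v) (step G i)  ≡⟨ VP.lookup-map (step G i) f v ⟩
  f (lookup v (step G i))        ≡⟨ cong f (commutes v-hom i) ⟩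
  f (step Z (lookup v i))        ≡⟨ commutes f-hom (lookup v i) ⟩
  step Z′ (f (lookup v i))       ≡⟨ cong (step Z′) (sym (VP.lookup-map i f v)) ⟩
  step Z′ (lookup (V.map f v) i) ∎
  where open ≡-Reasoning

∘ᵛ-inverse : ∀ {A : Set} {m n} (v : Vec A m) (f : Fin n → Fin m) (g : Fin m → Fin n) →
  (∀ i → f (g i) ≡ i) → (v ∘ᵛ f) ∘ᵛ g ≡ v
∘ᵛ-inverse v f g fg = ≗⇒≡ λ i → trans (VP.lookup∘tabulate _ i) (trans (VP.lookup∘tabulate _ (g i)) (cong (lookup v) (fg i)))

map-inverse : ∀ {A B : Set} {n} (v : Vec A n) (f : A → B) (g : B → A) → (∀ x → g (f x) ≡ x) → V.map g (V.map f v) ≡ v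
map-inverse v f g gf = trans (sym (VP.map-∘ g f v)) (trans (VP.map-cong gf v) (VP.map-id v))

≅-to-hom : ∀ {A B} (A≅B : A ≅ B) → IsHomFn A B (_≅_.to A≅B)
≅-to-hom A≅B = homFn (_≅_.commute A≅B)

homCount-≅ˡ : ∀ {G G′} Z → G ≅ G′ → homCount G Z ≡ homCount G′ Z
homCount-≅ˡ {G} {G′} Z G≅G′ = homCount-unique G Z (↔-trans
  (Hom-↔ G Z G′ Z (_∘ᵛ from) (_∘ᵛ to)
    (λ v h → ∘ᵛ-hom v h (≅-to-hom (≅-sym G≅G′))) (λ w h → ∘ᵛ-hom w h (≅-to-hom G≅G′))
    (λ v _ → ∘ᵛ-inverse v from to from-to) (λ w _ → ∘ᵛ-inverse w to from to-from))
  (Hom↔ G′ Z))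
  where open _≅_ G≅G′

homCount-≅ʳ : ∀ G {Z Z′} → Z ≅ Z′ → homCount G Z ≡ homCount G Z′
homCount-≅ʳ G {Z} {Z′} Z≅Z′ = homCount-unique G Z (↔-trans
  (Hom-↔ G Z G Z′ (V.map to) (V.map from)
    (λ v h → map-hom v h (≅-to-hom Z≅Z′)) (λ w h → map-hom w h (≅-to-hom (≅-sym Z≅Z′)))
    (λ v _ → map-inverse v to from from-to) (λ w _ → map-inverse w from to to-from))
  (Hom↔ G Z′))
  where open _≅_ Z≅Z′

↑ˡ-hom : ∀ A B → IsHomFn A (A ⊕ B) (_↑ˡ size B)
↑ˡ-hom A B = homFn λ i → sym (cong (F.join (size A) (size B) ∘ Sum.map (step A) (step B)) (FP.splitAt-↑ˡ (size A) i (size B)))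

↑ʳ-hom : ∀ A B → IsHomFn B (A ⊕ B) (size A ↑ʳ_)
↑ʳ-hom A B = homFn λ j → sym (cong (F.join (size A) (size B) ∘ Sum.map (step A) (step B)) (FP.splitAt-↑ʳ (size A) (size B) j))

splitAt-step : ∀ A B x → F.splitAt (size A) (step (A ⊕ B) x) ≡ Sum.map (step A) (step B) (F.splitAt (size A) x)
splitAt-step A B x = FP.splitAt-join (size A) (size B) _

remQuot-step : ∀ A B x → F.remQuot {size A} (size B) (step (A ⊗ B) x) ≡ Prod.map (step A) (step B) (F.remQuot {size A} (size B) x)
remQuot-step A B x = FP.remQuot-combine {size A} {size B} _ _

step-combine : ∀ A B i j → step (A ⊗ B) (F.combine i j) ≡ F.combine (step A i) (step B j)
step-combine A B i j = cong (uncurry F.combine ∘ Prod.map (step A) (step B)) (FP.remQuot-combine i j)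

⊗-proj₁ : ∀ A B → Fin (size (A ⊗ B)) → Fin (size A)
⊗-proj₁ A B = proj₁ ∘ F.remQuot {size A} (size B)

⊗-proj₂ : ∀ A B → Fin (size (A ⊗ B)) → Fin (size B)
⊗-proj₂ A B = proj₂ ∘ F.remQuot {size A} (size B)

proj₁-hom : ∀ A B → IsHomFn (A ⊗ B) A (⊗-proj₁ A B)
proj₁-hom A B = homFn λ x → cong proj₁ (remQuot-step A B x)

proj₂-hom : ∀ A B → IsHomFn (A ⊗ B) B (⊗-proj₂ A B)
proj₂-hom A B = homFn λ x → cong proj₂ (remQuot-step A B x)

Σ-∧-↔ : ∀ {A B : Set} {p : A → Bool} {q : B → Bool} →
  Σ (A × B) (λ (a , b) → T (p a ∧ q b)) ↔ (Σ A (T ∘ p) × Σ B (T ∘ q))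
Σ-∧-↔ = mk↔ₛ′
  (λ ((a , b) , t) → let s , t′ = Equivalence.to BP.T-∧ t in (a , s) , (b , t′))
  (λ ((a , s) , (b , t)) → (a , b) , Equivalence.from BP.T-∧ (s , t))
  (λ _ → cong₂ _,_ (Σ-T-≡ refl) (Σ-T-≡ refl))
  (λ _ → Σ-T-≡ refl)

homCount-⊗ʳ : ∀ G A B → homCount G (A ⊗ B) ≡ homCount G A * homCount G B
homCount-⊗ʳ G A B = homCount-unique G (A ⊗ B) (↔-trans
  (restrict-↔ unpair pair unpair-hom pair-hom unpair-pair pair-unpair)
  (↔-trans Σ-∧-↔ (↔-trans (×-cong (Hom↔ G A) (Hom↔ G B)) (↔-sym FP.*↔×))))
  where
  unpair : Map G (A ⊗ B) → Map G A × Map G B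
  unpair v = V.map (⊗-proj₁ A B) v , V.map (⊗-proj₂ A B) v
  pair : Map G A × Map G B → Map G (A ⊗ B)
  pair (u , w) = V.zipWith F.combine u w
  unpair-hom : ∀ v → T (isHom G (A ⊗ B) v) → T (isHom G A (proj₁ (unpair v)) ∧ isHom G B (proj₂ (unpair v)))
  unpair-hom v h = Equivalence.from BP.T-∧
    ( toHom _ (map-hom v (fromHom v h) (proj₁-hom A B))
    , toHom _ (map-hom v (fromHom v h) (proj₂-hom A B)))
  pair-hom : ∀ (uw : Map G A × Map G B) → T (isHom G A (proj₁ uw) ∧ isHom G B (proj₂ uw)) → T (isHom G (A ⊗ B) (pair uw))
  pair-hom (u , w) t = toHom {G} {A ⊗ B} (pair (u , w)) (homFn λ i → begin
    lookup (pair (u , w)) (step G i)                 ≡⟨ VP.lookup-zipWith F.combine (step G i) u w ⟩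
    F.combine (lookup u (step G i)) (lookup w (step G i)) ≡⟨ cong₂ F.combine (commutes u-hom i) (commutes w-hom i) ⟩
    F.combine (step A (lookup u i)) (step B (lookup w i)) ≡⟨ sym (step-combine A B _ _) ⟩
    step (A ⊗ B) (F.combine (lookup u i) (lookup w i))  ≡⟨ cong (step (A ⊗ B)) (sym (VP.lookup-zipWith F.combine i u w)) ⟩
    step (A ⊗ B) (lookup (pair (u , w)) i)            ∎)
    where
    open ≡-Reasoning
    u-hom = fromHom u (proj₁ (Equivalence.to BP.T-∧ t))
    w-hom = fromHom w (proj₂ (Equivalence.to BP.T-∧ t))
  unpair-pair : ∀ v → T (isHom G (A ⊗ B) v) → pair (unpair v) ≡ v
  unpair-pair v _ = ≗⇒≡ λ i → begin
    lookup (pair (unpair v)) i ≡⟨ VP.lookup-zipWith F.combine i (proj₁ (unpair v)) (proj₂ (unpair v)) ⟩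
    F.combine (lookup (proj₁ (unpair v)) i) (lookup (proj₂ (unpair v)) i)
      ≡⟨ cong₂ F.combine (VP.lookup-map i (⊗-proj₁ A B) v) (VP.lookup-map i (⊗-proj₂ A B) v) ⟩
    uncurry F.combine (F.remQuot {size A} (size B) (lookup v i)) ≡⟨ FP.combine-remQuot {size A} (size B) (lookup v i) ⟩
    lookup v i ∎
    where open ≡-Reasoning
  pair-unpair : ∀ uw → T (isHom G A (proj₁ uw) ∧ isHom G B (proj₂ uw)) → unpair (pair uw) ≡ uw
  pair-unpair (u , w) _ = cong₂ _,_
    (≗⇒≡ λ i → trans (VP.lookup-map i (⊗-proj₁ A B) (pair (u , w)))
      (trans (cong (⊗-proj₁ A B) (VP.lookup-zipWith F.combine i u w)) (cong proj₁ (FP.remQuot-combine (lookup u i) (lookup w i)))))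
    (≗⇒≡ λ i → trans (VP.lookup-map i (⊗-proj₂ A B) (pair (u , w)))
      (trans (cong (⊗-proj₂ A B) (VP.lookup-zipWith F.combine i u w)) (cong proj₂ (FP.remQuot-combine (lookup u i) (lookup w i)))))

homCount-⊕ˡ : ∀ G H Z → homCount (G ⊕ H) Z ≡ homCount G Z * homCount H Z
homCount-⊕ˡ G H Z = homCount-unique (G ⊕ H) Z (↔-trans
  (restrict-↔ restrict (uncurry V._++_) restrict-hom append-hom append-restrict restrict-append)
  (↔-trans Σ-∧-↔ (↔-trans (×-cong (Hom↔ G Z) (Hom↔ H Z)) (↔-sym FP.*↔×))))
  where
  g = size G
  h = size H
  restrict : Map (G ⊕ H) Z → Map G Z × Map H Z
  restrict v = v ∘ᵛ (_↑ˡ h) , v ∘ᵛ (g ↑ʳ_)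
  restrict-hom : ∀ v → T (isHom (G ⊕ H) Z v) → T (isHom G Z (proj₁ (restrict v)) ∧ isHom H Z (proj₂ (restrict v)))
  restrict-hom v t = Equivalence.from BP.T-∧
    ( toHom _ (∘ᵛ-hom v (fromHom v t) (↑ˡ-hom G H))
    , toHom _ (∘ᵛ-hom v (fromHom v t) (↑ʳ-hom G H)))
  append-hom : ∀ (uw : Map G Z × Map H Z) → T (isHom G Z (proj₁ uw) ∧ isHom H Z (proj₂ uw)) → T (isHom (G ⊕ H) Z (uncurry V._++_ uw))
  append-hom (u , w) t = toHom (u V.++ w) (homFn λ x → begin
    lookup (u V.++ w) (step (G ⊕ H) x)                              ≡⟨ VP.lookup-splitAt g u w _ ⟩
    [ lookup u , lookup w ]′ (F.splitAt g (step (G ⊕ H) x))        ≡⟨ cong [ lookup u , lookup w ]′ (splitAt-step G H x) ⟩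
    [ lookup u , lookup w ]′ (Sum.map (step G) (step H) (F.splitAt g x)) ≡⟨ on-sides (F.splitAt g x) ⟩
    step Z ([ lookup u , lookup w ]′ (F.splitAt g x))                ≡⟨ cong (step Z) (sym (VP.lookup-splitAt g u w x)) ⟩
    step Z (lookup (u V.++ w) x)                                     ∎)
    where
    open ≡-Reasoning
    on-sides : ∀ s → [ lookup u , lookup w ]′ (Sum.map (step G) (step H) s) ≡ step Z ([ lookup u , lookup w ]′ s)
    on-sides (inj₁ i) = commutes (fromHom u (proj₁ (Equivalence.to BP.T-∧ t))) i
    on-sides (inj₂ j) = commutes (fromHom w (proj₂ (Equivalence.to BP.T-∧ t))) j
  append-restrict : ∀ v → T (isHom (G ⊕ H) Z v) → uncurry V._++_ (restrict v) ≡ v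
  append-restrict v _ = ≗⇒≡ λ x → trans (VP.lookup-splitAt g (proj₁ (restrict v)) (proj₂ (restrict v)) x) (on-sides (F.splitAt g x) refl)
    where
    on-sides : ∀ {x} s → F.splitAt g x ≡ s → [ lookup (proj₁ (restrict v)) , lookup (proj₂ (restrict v)) ]′ s ≡ lookup v x
    on-sides (inj₁ i) eq = trans (VP.lookup∘tabulate _ i) (cong (lookup v) (FP.splitAt⁻¹-↑ˡ eq))
    on-sides (inj₂ j) eq = trans (VP.lookup∘tabulate _ j) (cong (lookup v) (FP.splitAt⁻¹-↑ʳ eq))
  restrict-append : ∀ uw → T (isHom G Z (proj₁ uw) ∧ isHom H Z (proj₂ uw)) → restrict (uncurry V._++_ uw) ≡ uw
  restrict-append (u , w) _ = cong₂ _,_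
    (≗⇒≡ λ i → trans (VP.lookup∘tabulate _ i) (VP.lookup-++ˡ u w i))
    (≗⇒≡ λ j → trans (VP.lookup∘tabulate _ j) (VP.lookup-++ʳ u w j))

Fin1-irrelevant : (x y : Fin 1) → x ≡ y
Fin1-irrelevant zero zero = refl

homCount-𝟙ʳ : ∀ G → homCount G 𝟙 ≡ 1
homCount-𝟙ʳ G = homCount-unique G 𝟙 (mk↔ₛ′ (λ _ → zero) (λ _ → const , toHom const (tabulate-hom (homFn λ _ → refl)))
  (Fin1-irrelevant zero) (λ (v , _) → Σ-T-≡ (≗⇒≡ λ i → Fin1-irrelevant _ _)))
  where
  const : Map G 𝟙
  const = tabulate (λ _ → zero)

homCount-𝟘ʳ : ∀ G → size G > 0 → homCount G 𝟘 ≡ 0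
homCount-𝟘ʳ G size>0 = homCount-unique G 𝟘 (mk↔ₛ′ (λ (v , _) → lookup v i₀) (λ ()) (λ ()) (λ (v , _) → ⊥-elim (FP.¬Fin0 (lookup v i₀))))
  where i₀ = F.fromℕ< size>0

homCount-𝟘ˡ : ∀ Z → homCount 𝟘 Z ≡ 1
homCount-𝟘ˡ Z = homCount-unique 𝟘 Z (mk↔ₛ′ (λ _ → zero) (λ _ → [] , toHom [] (homFn λ ()))
  (Fin1-irrelevant zero) (λ { ([] , _) → Σ-T-≡ refl }))

connected-const : ∀ G {X : Set} (φ : Fin (size G) → X) → (∀ i → φ (step G i) ≡ φ i) →
  Connected G → ∀ i j → φ i ≡ φ j
connected-const G φ φ-inv (_ , conn) i j = EC.fold (record { refl = refl ; sym = sym ; trans = trans })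
  (λ {i} arc → trans (sym (φ-inv i)) (cong φ arc)) (conn i j)

isLeft : ∀ {A B : Set} → A ⊎ B → Bool
isLeft (inj₁ _) = true
isLeft (inj₂ _) = false

isLeft-map : ∀ {A B C D : Set} (f : A → C) (g : B → D) s → isLeft (Sum.map f g s) ≡ isLeft s
isLeft-map f g (inj₁ _) = refl
isLeft-map f g (inj₂ _) = refl

isLeft⇒inj₁ : ∀ {A B : Set} {c : B → A} s → isLeft s ≡ true → s ≡ inj₁ (Sum.fromInj₁ c s)
isLeft⇒inj₁ (inj₁ _) _ = refl

isRight⇒inj₂ : ∀ {A B : Set} {c : A → B} s → isLeft s ≡ false → s ≡ inj₂ (Sum.fromInj₂ c s)
isRight⇒inj₂ (inj₂ _) _ = refl

Σ-⊎-↔ : ∀ {A B : Set} {p : A → Bool} {q : B → Bool} →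
  Σ (A ⊎ B) (T ∘ [ p , q ]′) ↔ (Σ A (T ∘ p) ⊎ Σ B (T ∘ q))
Σ-⊎-↔ = mk↔ₛ′
  (λ { (inj₁ a , t) → inj₁ (a , t) ; (inj₂ b , t) → inj₂ (b , t) })
  (λ { (inj₁ (a , t)) → inj₁ a , t ; (inj₂ (b , t)) → inj₂ b , t })
  (λ { (inj₁ _) → refl ; (inj₂ _) → refl })
  (λ { (inj₁ _ , _) → refl ; (inj₂ _ , _) → refl })

module _ (G A B : FDDS) (G-conn : Connected G) where
  private
    a = size A
    b = size B
    i₀ : Fin (size G)
    i₀ = F.fromℕ< (proj₁ G-conn)
    side : Map G (A ⊕ B) → Fin (size G) → Fin a ⊎ Fin b
    side v = F.splitAt a ∘ lookup v

    side-constant : ∀ v → IsHom G (A ⊕ B) v → ∀ i → isLeft (side v i) ≡ isLeft (side v i₀)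
    side-constant v v-hom i = connected-const G (isLeft ∘ side v) side-step G-conn i i₀
      where
      side-step : ∀ i → isLeft (side v (step G i)) ≡ isLeft (side v i)
      side-step i = trans (cong (isLeft ∘ F.splitAt a) (commutes v-hom i))
        (trans (cong isLeft (splitAt-step A B (lookup v i))) (isLeft-map (step A) (step B) _))

    leftPart : Fin a → Map G (A ⊕ B) → Map G A
    leftPart d = V.map (Sum.fromInj₁ (λ _ → d) ∘ F.splitAt a)

    rightPart : Fin b → Map G (A ⊕ B) → Map G B
    rightPart e = V.map (Sum.fromInj₂ (λ _ → e) ∘ F.splitAt a)

    split : Map G (A ⊕ B) → Map G A ⊎ Map G B
    split v = [ (λ d → inj₁ (leftPart d v)) , (λ e → inj₂ (rightPart e v)) ]′ (side v i₀)

    merge : Map G A ⊎ Map G B → Map G (A ⊕ B)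
    merge = [ V.map (_↑ˡ b) , V.map (a ↑ʳ_) ]′

    merge-hom : ∀ uw → T ([ isHom G A , isHom G B ]′ uw) → T (isHom G (A ⊕ B) (merge uw))
    merge-hom (inj₁ u) t = toHom _ (map-hom u (fromHom u t) (↑ˡ-hom A B))
    merge-hom (inj₂ w) t = toHom _ (map-hom w (fromHom w t) (↑ʳ-hom A B))

    split-merge : ∀ uw → T ([ isHom G A , isHom G B ]′ uw) → split (merge uw) ≡ uw
    split-merge (inj₁ u) _ = begin
      split (merge (inj₁ u))
        ≡⟨ cong [ _ , _ ]′ (trans (cong (F.splitAt a) (VP.lookup-map i₀ (_↑ˡ b) u)) (FP.splitAt-↑ˡ a _ b)) ⟩
      inj₁ (leftPart (lookup u i₀) (V.map (_↑ˡ b) u))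
        ≡⟨ cong inj₁ (trans (sym (VP.map-∘ _ (_↑ˡ b) u)) (trans (VP.map-cong (λ i → cong [ _ , _ ]′ (FP.splitAt-↑ˡ a i b)) u) (VP.map-id u))) ⟩
      inj₁ u                                            ∎
      where open ≡-Reasoning
    split-merge (inj₂ w) _ = begin
      split (merge (inj₂ w))
        ≡⟨ cong [ _ , _ ]′ (trans (cong (F.splitAt a) (VP.lookup-map i₀ (a ↑ʳ_) w)) (FP.splitAt-↑ʳ a b _)) ⟩
      inj₂ (rightPart (lookup w i₀) (V.map (a ↑ʳ_) w))
        ≡⟨ cong inj₂ (trans (sym (VP.map-∘ _ (a ↑ʳ_) w)) (trans (VP.map-cong (λ j → cong [ _ , _ ]′ (FP.splitAt-↑ʳ a b j)) w) (VP.map-id w))) ⟩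
      inj₂ w                                            ∎
      where open ≡-Reasoning

    module _ (v : Map G (A ⊕ B)) (v-hom : IsHom G (A ⊕ B) v) where
      module Left {d} (eq : side v i₀ ≡ inj₁ d) where
        ℓ : Fin a ⊎ Fin b → Fin a
        ℓ = Sum.fromInj₁ (λ _ → d)
        u : Map G A
        u = leftPart d v

        everywhere : ∀ i → side v i ≡ inj₁ (ℓ (side v i))
        everywhere i = isLeft⇒inj₁ _ (trans (side-constant v v-hom i) (cong isLeft eq))

        u-hom : IsHom G A u
        u-hom = homFn λ i → inj₁-injective (begin
          inj₁ (lookup u (step G i))               ≡⟨ cong inj₁ (VP.lookup-map (step G i) (ℓ ∘ F.splitAt a) v) ⟩
          inj₁ (ℓ (side v (step G i)))             ≡⟨ sym (everywhere (step G i)) ⟩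
          side v (step G i)                        ≡⟨ cong (F.splitAt a) (commutes v-hom i) ⟩
          F.splitAt a (step (A ⊕ B) (lookup v i))  ≡⟨ splitAt-step A B (lookup v i) ⟩
          Sum.map (step A) (step B) (side v i)     ≡⟨ cong (Sum.map (step A) (step B)) (everywhere i) ⟩
          inj₁ (step A (ℓ (side v i)))             ≡⟨ cong (inj₁ ∘ step A) (sym (VP.lookup-map i (ℓ ∘ F.splitAt a) v)) ⟩
          inj₁ (step A (lookup u i))               ∎)
          where open ≡-Reasoning

        merge-u : V.map (_↑ˡ b) u ≡ v
        merge-u = ≗⇒≡ λ i → trans (VP.lookup-map i (_↑ˡ b) u)
          (trans (cong (_↑ˡ b) (VP.lookup-map i (ℓ ∘ F.splitAt a) v)) (FP.splitAt⁻¹-↑ˡ (everywhere i)))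

      module Right {e} (eq : side v i₀ ≡ inj₂ e) where
        r : Fin a ⊎ Fin b → Fin b
        r = Sum.fromInj₂ (λ _ → e)
        w : Map G B
        w = rightPart e v

        everywhere : ∀ i → side v i ≡ inj₂ (r (side v i))
        everywhere i = isRight⇒inj₂ _ (trans (side-constant v v-hom i) (cong isLeft eq))

        w-hom : IsHom G B w
        w-hom = homFn λ i → inj₂-injective (begin
          inj₂ (lookup w (step G i))               ≡⟨ cong inj₂ (VP.lookup-map (step G i) (r ∘ F.splitAt a) v) ⟩
          inj₂ (r (side v (step G i)))             ≡⟨ sym (everywhere (step G i)) ⟩
          side v (step G i)                        ≡⟨ cong (F.splitAt a) (commutes v-hom i) ⟩
          F.splitAt a (step (A ⊕ B) (lookup v i))  ≡⟨ splitAt-step A B (lookup v i) ⟩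
          Sum.map (step A) (step B) (side v i)     ≡⟨ cong (Sum.map (step A) (step B)) (everywhere i) ⟩
          inj₂ (step B (r (side v i)))             ≡⟨ cong (inj₂ ∘ step B) (sym (VP.lookup-map i (r ∘ F.splitAt a) v)) ⟩
          inj₂ (step B (lookup w i))               ∎)
          where open ≡-Reasoning

        merge-w : V.map (a ↑ʳ_) w ≡ v
        merge-w = ≗⇒≡ λ i → trans (VP.lookup-map i (a ↑ʳ_) w)
          (trans (cong (a ↑ʳ_) (VP.lookup-map i (r ∘ F.splitAt a) v)) (FP.splitAt⁻¹-↑ʳ (everywhere i)))

    split-hom : ∀ v → T (isHom G (A ⊕ B) v) → T ([ isHom G A , isHom G B ]′ (split v))
    split-hom v t with side v i₀ in eq
    ... | inj₁ _ = toHom _ (Left.u-hom v (fromHom v t) eq)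
    ... | inj₂ _ = toHom _ (Right.w-hom v (fromHom v t) eq)

    merge-split : ∀ v → T (isHom G (A ⊕ B) v) → merge (split v) ≡ v
    merge-split v t with side v i₀ in eq
    ... | inj₁ _ = Left.merge-u v (fromHom v t) eq
    ... | inj₂ _ = Right.merge-w v (fromHom v t) eq

  homCount-⊕ʳ : homCount G (A ⊕ B) ≡ homCount G A + homCount G B
  homCount-⊕ʳ = homCount-unique G (A ⊕ B) (↔-trans
    (restrict-↔ split merge split-hom merge-hom merge-split split-merge)
    (↔-trans Σ-⊎-↔ (↔-trans (⊎-cong (Hom↔ G A) (Hom↔ G B)) (↔-sym FP.+↔⊎))))

homCount-^ʳ : ∀ G Z i → homCount G (Z ^ i) ≡ homCount G Z ℕ.^ i
homCount-^ʳ G Z zero    = homCount-𝟙ʳ G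
homCount-^ʳ G Z (suc i) = trans (homCount-⊗ʳ G Z (Z ^ i)) (cong (homCount G Z *_) (homCount-^ʳ G Z i))

polyFrom : ∀ {k} → ℕ → Vec ℕ k → ℕ → ℕ
polyFrom i []       x = 0
polyFrom i (c ∷ cs) x = c * x ℕ.^ i + polyFrom (suc i) cs x

homCount-evalFrom : ∀ G → Connected G → ∀ {k} i (As : Vec FDDS k) Z →
  homCount G (evalFrom i As Z) ≡ polyFrom i (V.map (homCount G) As) (homCount G Z)
homCount-evalFrom G G-conn i []       Z = homCount-𝟘ʳ G (proj₁ G-conn)
homCount-evalFrom G G-conn i (A ∷ As) Z = begin
  homCount G (A ⊗ Z ^ i ⊕ evalFrom (suc i) As Z)             ≡⟨ homCount-⊕ʳ G _ _ G-conn ⟩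
  homCount G (A ⊗ Z ^ i) + homCount G (evalFrom (suc i) As Z)
    ≡⟨ cong₂ _+_ (homCount-⊗ʳ G A (Z ^ i)) (homCount-evalFrom G G-conn (suc i) As Z) ⟩
  homCount G A * homCount G (Z ^ i) + rest                    ≡⟨ cong (λ n → homCount G A * n + rest) (homCount-^ʳ G Z i) ⟩
  homCount G A * homCount G Z ℕ.^ i + rest                    ∎
  where
  open ≡-Reasoning
  rest = polyFrom (suc i) (V.map (homCount G) As) (homCount G Z)

homCount>0⇒hom : ∀ G Z → 0 < homCount G Z → ∃ λ v → IsHom G Z v
homCount>0⇒hom G Z pos = let v , t = Inverse.from (Hom↔ G Z) (F.fromℕ< pos) in v , fromHom v t

fixedPoint⇒homCount>0 : ∀ G Z {z} → step Z z ≡ z → 0 < homCount G Z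
fixedPoint⇒homCount>0 G Z {z} fixed =
  ℕP.≤-<-trans z≤n (FP.toℕ<n (Inverse.to (Hom↔ G Z) (const , toHom const (tabulate-hom (homFn λ _ → sym fixed)))))
  where
  const : Map G Z
  const = tabulate (λ _ → z)

noFixedPoint⇒homCount≡0 : ∀ Z → (∀ z → step Z z ≢ z) → homCount 𝟙 Z ≡ 0
noFixedPoint⇒homCount≡0 Z no-fix = homCount-unique 𝟙 Z (mk↔ₛ′ (⊥-elim ∘ fixed) (λ ()) (λ ()) (⊥-elim ∘ fixed))
  where
  fixed : Hom 𝟙 Z → ⊥
  fixed (v , t) = no-fix (lookup v zero) (sym (commutes (fromHom v t) zero))

-- Orbits, sub-systems and connected components

iterate : ∀ {A : Set} → (A → A) → ℕ → A → A
iterate f zero    x = x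
iterate f (suc k) x = f (iterate f k x)

module _ {A : Set} (f : A → A) where

  iterate-+ : ∀ m n x → iterate f (m + n) x ≡ iterate f m (iterate f n x)
  iterate-+ zero    n x = refl
  iterate-+ (suc m) n x = cong f (iterate-+ m n x)

  iterate-comm : ∀ m n x → iterate f m (iterate f n x) ≡ iterate f n (iterate f m x)
  iterate-comm m n x = trans (sym (iterate-+ m n x)) (trans (cong (λ k → iterate f k x) (ℕP.+-comm m n)) (iterate-+ n m x))

  iterate-periodic : ∀ {p y} → iterate f p y ≡ y → ∀ k → iterate f (k * p) y ≡ y
  iterate-periodic         p-periodic zero    = refl
  iterate-periodic {p} {y} p-periodic (suc k) = begin
    iterate f (p + k * p) y          ≡⟨ iterate-+ p (k * p) y ⟩
    iterate f p (iterate f (k * p) y) ≡⟨ cong (iterate f p) (iterate-periodic p-periodic k) ⟩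
    iterate f p y                    ≡⟨ p-periodic ⟩
    y                                ∎
    where open ≡-Reasoning

  iterate-mod : ∀ {p y} .{{_ : ℕ.NonZero p}} → iterate f p y ≡ y → ∀ k → iterate f k y ≡ iterate f (k % p) y
  iterate-mod {p} {y} p-periodic k = begin
    iterate f k y                                   ≡⟨ cong (λ m → iterate f m y) (m≡m%n+[m/n]*n k p) ⟩
    iterate f (k % p + k / p * p) y                 ≡⟨ iterate-+ (k % p) (k / p * p) y ⟩
    iterate f (k % p) (iterate f (k / p * p) y)     ≡⟨ cong (iterate f (k % p)) (iterate-periodic p-periodic (k / p)) ⟩
    iterate f (k % p) y                             ∎
    where open ≡-Reasoning

hom-iterate : ∀ {G Z f} → IsHomFn G Z f → ∀ k x → f (iterate (step G) k x) ≡ iterate (step Z) k (f x)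
hom-iterate         f-hom zero    x = refl
hom-iterate {Z = Z} f-hom (suc k) x = trans (commutes f-hom _) (cong (step Z) (hom-iterate f-hom k x))

eventually-periodic : ∀ G x → let w = iterate (step G) (size G) x in
  ∃ λ q → suc q ≤ size G × iterate (step G) (suc q) w ≡ w
eventually-periodic G x with FP.pigeonhole (ℕP.n<1+n (size G)) (λ (k : Fin (suc (size G))) → iterate (step G) (toℕ k) x)
... | i , j , i<j , xᵢ≡xⱼ
    with ℕP.m≤n⇒∃[o]m+o≡n i<j | ℕP.m≤n⇒∃[o]m+o≡n (ℕP.≤-trans (ℕP.<⇒≤ i<j) (ℕP.≤-pred (FP.toℕ<n j)))
... | q , i+1+q≡j | r , i+r≡n = q , q<n , periodic
  where
  n = size G
  it = iterate (step G)
  q+1+i≡j : suc q + toℕ i ≡ toℕ j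
  q+1+i≡j = trans (ℕP.+-comm (suc q) (toℕ i)) (trans (ℕP.+-suc (toℕ i) q) i+1+q≡j)
  q<n : suc q ≤ n
  q<n = ℕP.≤-trans (ℕP.m≤m+n (suc q) (toℕ i)) (ℕP.≤-trans (ℕP.≤-reflexive q+1+i≡j) (ℕP.≤-pred (FP.toℕ<n j)))
  xₙ≡ : it n x ≡ it r (it (toℕ i) x)
  xₙ≡ = trans (cong (λ m → it m x) (trans (sym i+r≡n) (ℕP.+-comm (toℕ i) r))) (iterate-+ (step G) r (toℕ i) x)
  periodic : it (suc q) (it n x) ≡ it n x
  periodic = begin
    it (suc q) (it n x)            ≡⟨ cong (it (suc q)) xₙ≡ ⟩
    it (suc q) (it r (it (toℕ i) x)) ≡⟨ iterate-comm (step G) (suc q) r _ ⟩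
    it r (it (suc q) (it (toℕ i) x)) ≡⟨ cong (it r) (sym (iterate-+ (step G) (suc q) (toℕ i) x)) ⟩
    it r (it (suc q + toℕ i) x)      ≡⟨ cong (λ m → it r (it m x)) q+1+i≡j ⟩
    it r (it (toℕ j) x)              ≡⟨ cong (it r) (sym xᵢ≡xⱼ) ⟩
    it r (it (toℕ i) x)              ≡⟨ sym xₙ≡ ⟩
    it n x                           ∎
    where open ≡-Reasoning

orbit-reduce : ∀ G x k → let n = size G in
  ∃ λ (j : Fin n) → iterate (step G) (n + k) x ≡ iterate (step G) (n + toℕ j) x
orbit-reduce G x k with eventually-periodic G x
... | q , q<n , periodic = F.fromℕ< k%p<n , (begin
  it (n + k) x          ≡⟨ cong (λ m → it m x) (ℕP.+-comm n k) ⟩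
  it (k + n) x          ≡⟨ iterate-+ (step G) k n x ⟩
  it k (it n x)         ≡⟨ iterate-mod (step G) periodic k ⟩
  it (k % suc q) (it n x) ≡⟨ sym (iterate-+ (step G) (k % suc q) n x) ⟩
  it (k % suc q + n) x  ≡⟨ cong (λ m → it (m + n) x) (sym (FP.toℕ-fromℕ< k%p<n)) ⟩
  it (toℕ (F.fromℕ< k%p<n) + n) x ≡⟨ cong (λ m → it m x) (ℕP.+-comm _ n) ⟩
  it (n + toℕ (F.fromℕ< k%p<n)) x ∎)
  where
  open ≡-Reasoning
  n = size G
  it = iterate (step G)
  k%p<n = ℕP.<-≤-trans (m%n<n k (suc q)) q<n

module Sub (G : FDDS) (p : Fin (size G) → Bool) (closed : ∀ {x} → T (p x) → T (p (step G x))) where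
  private
    E = count-↔ p

  ι : Fin (count p) → Fin (size G)
  ι y = proj₁ (Inverse.from E y)

  ι-∈ : ∀ y → T (p (ι y))
  ι-∈ y = proj₂ (Inverse.from E y)

  ρ : ∀ x → T (p x) → Fin (count p)
  ρ x x∈ = Inverse.to E (x , x∈)

  ι-ρ : ∀ x x∈ → ι (ρ x x∈) ≡ x
  ι-ρ x x∈ = cong proj₁ (Inverse.strictlyInverseʳ E (x , x∈))

  ρ-cong : ∀ {x x′} (x∈ : T (p x)) (x′∈ : T (p x′)) → x ≡ x′ → ρ x x∈ ≡ ρ x′ x′∈
  ρ-cong x∈ x′∈ refl = cong (ρ _) (BP.T-irrelevant x∈ x′∈)

  ρ-ι : ∀ y y∈ → ρ (ι y) y∈ ≡ y
  ρ-ι y y∈ = trans (ρ-cong y∈ (ι-∈ y) refl) (Inverse.strictlyInverseˡ E y)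

  ι-injective : ∀ {y y′} → ι y ≡ ι y′ → y ≡ y′
  ι-injective {y} {y′} eq = trans (sym (ρ-ι y (ι-∈ y))) (trans (ρ-cong _ _ eq) (ρ-ι y′ (ι-∈ y′)))

  sub : FDDS
  sub = fdds (count p) (λ y → ρ (step G (ι y)) (closed (ι-∈ y)))

  ι-hom : IsHomFn sub G ι
  ι-hom = homFn λ y → ι-ρ _ _

T⊎T-not : ∀ b → T b ⊎ T (not b)
T⊎T-not true  = inj₁ tt
T⊎T-not false = inj₂ tt

T∧T-not : ∀ {b} → T b → T (not b) → ⊥
T∧T-not {true} _ ()

module Split (G : FDDS) (p : Fin (size G) → Bool) (invariant : ∀ x → p (step G x) ≡ p x) where
  module In  = Sub G p (subst T (sym (invariant _)))
  module Out = Sub G (not ∘ p) (subst (T ∘ not) (sym (invariant _)))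

  private
    c₁ = count p
    c₂ = count (not ∘ p)

    to : Fin (size G) → Fin (c₁ + c₂)
    to x = [ (λ x∈ → In.ρ x x∈ ↑ˡ c₂) , (λ x∉ → c₁ ↑ʳ Out.ρ x x∉) ]′ (T⊎T-not (p x))

    from : Fin (c₁ + c₂) → Fin (size G)
    from z = [ In.ι , Out.ι ]′ (F.splitAt c₁ z)

    to-in : ∀ x x∈ → to x ≡ In.ρ x x∈ ↑ˡ c₂
    to-in x x∈ with T⊎T-not (p x)
    ... | inj₁ x∈′ = cong (_↑ˡ c₂) (In.ρ-cong x∈′ x∈ refl)
    ... | inj₂ x∉  = ⊥-elim (T∧T-not x∈ x∉)

    to-out : ∀ x x∉ → to x ≡ c₁ ↑ʳ Out.ρ x x∉
    to-out x x∉ with T⊎T-not (p x)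
    ... | inj₁ x∈  = ⊥-elim (T∧T-not x∈ x∉)
    ... | inj₂ x∉′ = cong (c₁ ↑ʳ_) (Out.ρ-cong x∉′ x∉ refl)

    from-to : ∀ x → from (to x) ≡ x
    from-to x with T⊎T-not (p x)
    ... | inj₁ x∈ = trans (cong [ In.ι , Out.ι ]′ (FP.splitAt-↑ˡ c₁ _ c₂)) (In.ι-ρ x x∈)
    ... | inj₂ x∉ = trans (cong [ In.ι , Out.ι ]′ (FP.splitAt-↑ʳ c₁ c₂ _)) (Out.ι-ρ x x∉)

    to-from : ∀ z → to (from z) ≡ z
    to-from z with F.splitAt c₁ z in eq
    ... | inj₁ y = trans (to-in (In.ι y) (In.ι-∈ y)) (trans (cong (_↑ˡ c₂) (In.ρ-ι y _)) (FP.splitAt⁻¹-↑ˡ eq))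
    ... | inj₂ y = trans (to-out (Out.ι y) (Out.ι-∈ y)) (trans (cong (c₁ ↑ʳ_) (Out.ρ-ι y _)) (FP.splitAt⁻¹-↑ʳ eq))

    commute : ∀ x → to (step G x) ≡ step (In.sub ⊕ Out.sub) (to x)
    commute x with T⊎T-not (p x)
    ... | inj₁ x∈ = begin
      to (step G x)                                  ≡⟨ to-in (step G x) sx∈ ⟩
      In.ρ (step G x) sx∈ ↑ˡ c₂                       ≡⟨ cong (_↑ˡ c₂) (In.ρ-cong _ _ (cong (step G) (sym (In.ι-ρ x x∈)))) ⟩
      step In.sub (In.ρ x x∈) ↑ˡ c₂                   ≡⟨ commutes (↑ˡ-hom In.sub Out.sub) (In.ρ x x∈) ⟩
      step (In.sub ⊕ Out.sub) (In.ρ x x∈ ↑ˡ c₂)       ∎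
      where
      open ≡-Reasoning
      sx∈ = subst T (sym (invariant x)) x∈
    ... | inj₂ x∉ = begin
      to (step G x)                                  ≡⟨ to-out (step G x) sx∉ ⟩
      c₁ ↑ʳ Out.ρ (step G x) sx∉                      ≡⟨ cong (c₁ ↑ʳ_) (Out.ρ-cong _ _ (cong (step G) (sym (Out.ι-ρ x x∉)))) ⟩
      c₁ ↑ʳ step Out.sub (Out.ρ x x∉)                 ≡⟨ commutes (↑ʳ-hom In.sub Out.sub) (Out.ρ x x∉) ⟩
      step (In.sub ⊕ Out.sub) (c₁ ↑ʳ Out.ρ x x∉)      ∎
      where
      open ≡-Reasoning
      sx∉ = subst (T ∘ not) (sym (invariant x)) x∉

  split-≅ : G ≅ In.sub ⊕ Out.sub
  split-≅ = record { to = to ; from = from ; from-to = from-to ; to-from = to-from ; commute = commute }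

module Component (G : FDDS) (v : Fin (size G)) where
  private
    n = size G
    it = iterate (step G)

  -- The orbits of x and v meet iff they end in the same cycle.  After n = size G steps
  -- both orbits are on their cycles, and n consecutive points of v's cycle cover it.
  meets? : Fin n → Bool
  meets? x = ⌊ FP.any? (λ (j : Fin n) → it n x FP.≟ it (n + toℕ j) v) ⌋

  meets⇒ : ∀ {x} → T (meets? x) → ∃ λ k → it n x ≡ it (n + k) v
  meets⇒ x-meets = let j , eq = toWitness x-meets in toℕ j , eq

  ⇒meets : ∀ {x} k → it n x ≡ it (n + k) v → T (meets? x)
  ⇒meets k eq = let j , eq′ = orbit-reduce G v k in fromWitness (j , trans eq eq′)

  meets-step : ∀ x → meets? (step G x) ≡ meets? x
  meets-step x = T-⇔⇒≡ backward forward
    where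
    open ≡-Reasoning
    forward : T (meets? x) → T (meets? (step G x))
    forward x-meets = let k , eq = meets⇒ x-meets in ⇒meets (suc k) (begin
      it n (step G x)      ≡⟨ iterate-comm (step G) n 1 x ⟩
      step G (it n x)      ≡⟨ cong (step G) eq ⟩
      it (suc (n + k)) v   ≡⟨ cong (λ m → it m v) (sym (ℕP.+-suc n k)) ⟩
      it (n + suc k) v     ∎)
    backward : T (meets? (step G x)) → T (meets? x)
    backward sx-meets = let k , eq = meets⇒ sx-meets ; q , _ , periodic = eventually-periodic G x in
      ⇒meets (q + k) (begin
        it n x                   ≡⟨ sym periodic ⟩
        it (suc q) (it n x)      ≡⟨ sym (iterate-comm (step G) q 1 (it n x)) ⟩
        it q (it 1 (it n x))     ≡⟨ cong (it q) (iterate-comm (step G) 1 n x) ⟩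
        it q (it n (step G x))   ≡⟨ cong (it q) eq ⟩
        it q (it (n + k) v)      ≡⟨ sym (iterate-+ (step G) q (n + k) v) ⟩
        it (q + (n + k)) v       ≡⟨ cong (λ m → it m v) (ℕP.+-comm q (n + k)) ⟩
        it ((n + k) + q) v       ≡⟨ cong (λ m → it m v) (trans (ℕP.+-assoc n k q) (cong (n +_) (ℕP.+-comm k q))) ⟩
        it (n + (q + k)) v       ∎)

  v-meets : T (meets? v)
  v-meets = ⇒meets 0 (cong (λ m → it m v) (sym (ℕP.+-identityʳ n)))

  connected⇒meets : Connected G → ∀ x → T (meets? x)
  connected⇒meets G-conn x = subst T (connected-const G meets? meets-step G-conn v x) v-meets

  open Split G meets? meets-step public using (split-≅)
  open Split.In G meets? meets-step public using (ι; ι-∈; ρ; ι-ρ; ι-hom; ι-injective) renaming (sub to component)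
  open Split.Out G meets? meets-step public using () renaming (sub to rest)

  v′ : Fin (size component)
  v′ = ρ v v-meets

  component-connected : Connected component
  component-connected = ℕP.≤-<-trans z≤n (FP.toℕ<n v′) ,
    λ y y′ → EC.transitive (Arc component) (to-v′ y) (EC.symmetric (Arc component) (to-v′ y′))
    where
    it′ = iterate (step component)
    path : ∀ k y → EqClosure (Arc component) y (it′ k y)
    path zero    y = EC.reflexive (Arc component)
    path (suc k) y = EC.transitive (Arc component) (path k y) (EC.return refl)
    to-v′ : ∀ y → EqClosure (Arc component) y v′
    to-v′ y = let k , eq = meets⇒ (ι-∈ y) in
      EC.transitive (Arc component) (path n y)
        (subst (λ z → EqClosure (Arc component) z v′) (sym (ι-injective (begin
          ι (it′ n y)         ≡⟨ hom-iterate ι-hom n y ⟩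
          it n (ι y)          ≡⟨ eq ⟩
          it (n + k) v        ≡⟨ cong (it (n + k)) (sym (ι-ρ v v-meets)) ⟩
          it (n + k) (ι v′)   ≡⟨ sym (hom-iterate ι-hom (n + k) v′) ⟩
          ι (it′ (n + k) v′)  ∎)))
          (EC.symmetric (Arc component) (path (n + k) v′)))
      where open ≡-Reasoning

  fixed⇒component-fixed : step G v ≡ v → step component v′ ≡ v′
  fixed⇒component-fixed fixed = ι-injective (begin
    ι (step component v′) ≡⟨ commutes ι-hom v′ ⟩
    step G (ι v′)         ≡⟨ cong (step G) (ι-ρ v v-meets) ⟩
    step G v              ≡⟨ fixed ⟩
    v                     ≡⟨ sym (ι-ρ v v-meets) ⟩
    ι v′                  ∎)
    where open ≡-Reasoning

fixedPoint⇒ContainsDendron : ∀ A {a} → step A a ≡ a → ContainsDendron A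
fixedPoint⇒ContainsDendron A {a} fixed =
  component , rest , (component-connected , v′ , fixed⇒component-fixed fixed) , split-≅
  where open Component A a

ContainsDendron⇒fixedPoint : ∀ A → ContainsDendron A → ∃ λ a → step A a ≡ a
ContainsDendron⇒fixedPoint A (D , B , (_ , d , fixed) , A≅D⊕B) = from (d ↑ˡ size B) , (begin
  step A (from (d ↑ˡ size B))   ≡⟨ sym (commutes (≅-to-hom (≅-sym A≅D⊕B)) (d ↑ˡ size B)) ⟩
  from (step (D ⊕ B) (d ↑ˡ size B)) ≡⟨ cong from (sym (commutes (↑ˡ-hom D B) d)) ⟩
  from (step D d ↑ˡ size B)     ≡⟨ cong (λ x → from (x ↑ˡ size B)) fixed ⟩
  from (d ↑ˡ size B)            ∎)
  where
  open _≅_ A≅D⊕B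
  open ≡-Reasoning

-- Lovász's theorem: hom counts determine an FDDS

size≡0⇒≅𝟘 : ∀ {H} → size H ≡ 0 → H ≅ 𝟘
size≡0⇒≅𝟘 {fdds zero f} refl = record { to = λ () ; from = λ () ; from-to = λ () ; to-from = λ () ; commute = λ () }

homCount-determined-by-connected : ∀ X Y → (∀ C → Connected C → homCount C X ≡ homCount C Y) →
  ∀ H → homCount H X ≡ homCount H Y
homCount-determined-by-connected X Y connected-eq H = go (size H) H ℕP.≤-refl
  where
  open ≡-Reasoning
  go : ∀ k H → size H ≤ k → homCount H X ≡ homCount H Y
  go k H size≤k with size H ℕ.≟ 0
  ... | yes size≡0 = begin
    homCount H X ≡⟨ homCount-≅ˡ X (size≡0⇒≅𝟘 size≡0) ⟩
    homCount 𝟘 X ≡⟨ trans (homCount-𝟘ˡ X) (sym (homCount-𝟘ˡ Y)) ⟩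
    homCount 𝟘 Y ≡⟨ sym (homCount-≅ˡ Y (size≡0⇒≅𝟘 size≡0)) ⟩
    homCount H Y ∎
  go zero    H size≤0 | no size≢0 = ⊥-elim (size≢0 (ℕP.n≤0⇒n≡0 size≤0))
  go (suc k) H size≤k | no size≢0 = begin
    homCount H X                            ≡⟨ homCount-≅ˡ X split-≅ ⟩
    homCount (component ⊕ rest) X           ≡⟨ homCount-⊕ˡ component rest X ⟩
    homCount component X * homCount rest X  ≡⟨ cong₂ _*_ (connected-eq component component-connected) (go k rest rest≤k) ⟩
    homCount component Y * homCount rest Y ≡⟨ sym (homCount-⊕ˡ component rest Y) ⟩
    homCount (component ⊕ rest) Y           ≡⟨ sym (homCount-≅ˡ Y split-≅) ⟩
    homCount H Y                            ∎
    where
    open Component H (F.fromℕ< (ℕP.n≢0⇒n>0 size≢0))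
    rest≤k : size rest ≤ k
    rest≤k = ℕP.≤-pred (ℕP.≤-trans (ℕP.+-monoˡ-≤ (size rest) (proj₁ component-connected))
      (ℕP.≤-trans (ℕP.≤-reflexive (sym (≅⇒size≡ split-≅))) size≤k))

⊆∧≢⇒⊂ : ∀ {n} {p q : Subset n} → p ⊆ q → p ≢ q → p ⊂ q
⊆∧≢⇒⊂ {n} {p} {q} p⊆q p≢q
  with FP.¬∀⟶∃¬ n (λ x → x ∈ q → x ∈ p) (λ x → (x SubsetP.∈? q) →-dec (x SubsetP.∈? p))
         (λ q⊆p → p≢q (SubsetP.⊆-antisym p⊆q (q⊆p _)))
... | x , q⇏p = p⊆q , x , decidable-stable (x SubsetP.∈? q) (λ x∉q → q⇏p (⊥-elim ∘ x∉q)) , (λ x∈p → q⇏p (λ _ → x∈p))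

module Image {G Z₀ : FDDS} (κ : Map G Z₀) (κ-hom : IsHom G Z₀ κ) where
  inImage? : Fin (size Z₀) → Bool
  inImage? z = ⌊ FP.any? (λ i → lookup κ i FP.≟ z) ⌋

  private
    closed : ∀ {z} → T (inImage? z) → T (inImage? (step Z₀ z))
    closed z∈ = let i , κi≡z = toWitness z∈ in fromWitness (step G i , trans (commutes κ-hom i) (cong (step Z₀) κi≡z))

  open Sub Z₀ inImage? closed public renaming (sub to image)

  π : Fin (size G) → Fin (size image)
  π i = ρ (lookup κ i) (fromWitness (i , refl))

  ι-π : ∀ i → ι (π i) ≡ lookup κ i
  ι-π i = ι-ρ _ _

  π-hom : IsHomFn G image π
  π-hom = homFn λ i → ι-injective (begin
    ι (π (step G i))          ≡⟨ ι-π (step G i) ⟩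
    lookup κ (step G i)       ≡⟨ commutes κ-hom i ⟩
    step Z₀ (lookup κ i)      ≡⟨ cong (step Z₀) (sym (ι-π i)) ⟩
    step Z₀ (ι (π i))         ≡⟨ sym (commutes ι-hom (π i)) ⟩
    ι (step image (π i))      ∎)
    where open ≡-Reasoning

  π-ι : ∀ {i y} → lookup κ i ≡ ι y → π i ≡ y
  π-ι eq = ι-injective (trans (ι-π _) eq)

  preimage : Fin (size image) → Fin (size G)
  preimage y = proj₁ (toWitness (ι-∈ y))

  κ-preimage : ∀ y → lookup κ (preimage y) ≡ ι y
  κ-preimage y = proj₂ (toWitness (ι-∈ y))

module Kernels (G : FDDS) where
  private
    g = size G

  -- A kernel is a set of pairs of states, the pair (i , j) being encoded as combine i j.
  Kernel : Set
  Kernel = Subset (g * g)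

  ker : ∀ {z} → Vec (Fin z) g → Kernel
  ker v = tabulate (λ x → let i , j = F.remQuot g x in ⌊ lookup v i FP.≟ lookup v j ⌋)

  lookup-ker : ∀ {z} (v : Vec (Fin z) g) i j → lookup (ker v) (F.combine i j) ≡ ⌊ lookup v i FP.≟ lookup v j ⌋
  lookup-ker v i j = trans (VP.lookup∘tabulate _ (F.combine i j))
    (cong (λ (i , j) → ⌊ lookup v i FP.≟ lookup v j ⌋) (FP.remQuot-combine i j))

  ∈ker⇒ : ∀ {z} (v : Vec (Fin z) g) {i j} → F.combine i j ∈ ker v → lookup v i ≡ lookup v j
  ∈ker⇒ v {i} {j} ij∈ = toWitness (Equivalence.from BP.T-≡ (trans (sym (lookup-ker v i j)) (VP.[]=⇒lookup ij∈)))

  ⇒∈ker : ∀ {z} (v : Vec (Fin z) g) {i j} → lookup v i ≡ lookup v j → F.combine i j ∈ ker v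
  ⇒∈ker v {i} {j} eq = VP.lookup⇒[]= _ (ker v) (trans (lookup-ker v i j) (Equivalence.to BP.T-≡ (fromWitness eq)))

  ker⊆⇒ : ∀ {z z′} (v : Vec (Fin z) g) (w : Vec (Fin z′) g) → ker v ⊆ ker w →
    ∀ {i j} → lookup v i ≡ lookup v j → lookup w i ≡ lookup w j
  ker⊆⇒ v w v⊆w eq = ∈ker⇒ w (v⊆w (⇒∈ker v eq))

  ⇒ker⊆ : ∀ {z z′} (v : Vec (Fin z) g) (w : Vec (Fin z′) g) →
    (∀ {i j} → lookup v i ≡ lookup v j → lookup w i ≡ lookup w j) → ker v ⊆ ker w
  ⇒ker⊆ v w v⇒w {x} x∈ with F.remQuot {g} g x in eq
  ... | i , j = subst (_∈ ker w) x≡ij (⇒∈ker w (v⇒w (∈ker⇒ v (subst (_∈ ker v) (sym x≡ij) x∈))))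
    where
    x≡ij : F.combine i j ≡ x
    x≡ij = trans (cong (uncurry F.combine) (sym eq)) (FP.combine-remQuot {g} g x)

  above? : ∀ Z → Kernel → Map G Z → Bool
  above? Z K v = isHom G Z v ∧ ⌊ K SubsetP.⊆? ker v ⌋

  exactly? : ∀ Z → Kernel → Map G Z → Bool
  exactly? Z K v = isHom G Z v ∧ ⌊ VP.≡-dec BP._≟_ (ker v) K ⌋

  above⇒ : ∀ {Z K} v → T (above? Z K v) → IsHom G Z v × K ⊆ ker v
  above⇒ v t = let h , K⊆ = Equivalence.to BP.T-∧ t in fromHom v h , λ {x} → toWitness K⊆ {x}

  ⇒above : ∀ {Z K} v → IsHom G Z v → K ⊆ ker v → T (above? Z K v)
  ⇒above v v-hom K⊆ = Equivalence.from BP.T-∧ (toHom v v-hom , fromWitness (λ {x} → K⊆ {x}))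

  exactly⇒ : ∀ {Z K} v → T (exactly? Z K v) → IsHom G Z v × ker v ≡ K
  exactly⇒ v t = let h , ker≡ = Equivalence.to BP.T-∧ t in fromHom v h , toWitness ker≡

  ⇒exactly : ∀ {Z K} v → IsHom G Z v → ker v ≡ K → T (exactly? Z K v)
  ⇒exactly v v-hom ker≡ = Equivalence.from BP.T-∧ (toHom v v-hom , fromWitness ker≡)

  homsAbove : FDDS → Kernel → ℕ
  homsAbove Z K = countBy (Map↔ G Z) (above? Z K)

  homsWith : FDDS → Kernel → ℕ
  homsWith Z K = countBy (Map↔ G Z) (exactly? Z K)

  homsWith>0⇒ : ∀ Z K → 0 < homsWith Z K → ∃ λ v → IsHom G Z v × ker v ≡ K
  homsWith>0⇒ Z K pos = let i , t = count>0⇒∃ (exactly? Z K ∘ Inverse.from (Map↔ G Z)) pos in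
    Inverse.from (Map↔ G Z) i , exactly⇒ _ t

  ⇒homsWith>0 : ∀ Z K v → IsHom G Z v → ker v ≡ K → 0 < homsWith Z K
  ⇒homsWith>0 Z K v v-hom ker≡ = ∃⇒count>0 (exactly? Z K ∘ Inverse.from (Map↔ G Z))
    (subst (T ∘ exactly? Z K) (sym (Inverse.strictlyInverseʳ (Map↔ G Z) v)) (⇒exactly v v-hom ker≡))

  homsAbove-ker : ∀ {Z₀} (κ : Map G Z₀) (κ-hom : IsHom G Z₀ κ) Z → homsAbove Z (ker κ) ≡ homCount (Image.image κ κ-hom) Z
  homsAbove-ker {Z₀} κ κ-hom Z = sym (homCount-unique image Z
    (↔-trans (restrict-↔ Φ Ψ Φ-above Ψ-hom ΨΦ ΦΨ) (countBy-↔ (Map↔ G Z) (above? Z (ker κ)))))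
    where
    open Image κ κ-hom
    open ≡-Reasoning
    Φ : Map image Z → Map G Z
    Φ w = w ∘ᵛ π
    Ψ : Map G Z → Map image Z
    Ψ u = u ∘ᵛ preimage
    π-cong : ∀ {i j} → lookup κ i ≡ lookup κ j → π i ≡ π j
    π-cong eq = π-ι (trans eq (sym (ι-π _)))
    Φ-above : ∀ w → T (isHom image Z w) → T (above? Z (ker κ) (Φ w))
    Φ-above w t = ⇒above (Φ w) (∘ᵛ-hom w (fromHom w t) π-hom) (⇒ker⊆ κ (Φ w) λ {i} {j} eq →
      trans (VP.lookup∘tabulate _ i) (trans (cong (lookup w) (π-cong eq)) (sym (VP.lookup∘tabulate _ j))))
    Ψ-hom : ∀ u → T (above? Z (ker κ) u) → T (isHom image Z (Ψ u))
    Ψ-hom u t = let u-hom , κ⊆u = above⇒ u t in toHom (Ψ u) (homFn λ y → begin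
      lookup (Ψ u) (step image y)            ≡⟨ VP.lookup∘tabulate _ (step image y) ⟩
      lookup u (preimage (step image y))     ≡⟨ ker⊆⇒ κ u κ⊆u (begin
        lookup κ (preimage (step image y))     ≡⟨ κ-preimage _ ⟩
        ι (step image y)                       ≡⟨ commutes ι-hom y ⟩
        step Z₀ (ι y)                          ≡⟨ cong (step Z₀) (sym (κ-preimage y)) ⟩
        step Z₀ (lookup κ (preimage y))        ≡⟨ sym (commutes κ-hom _) ⟩
        lookup κ (step G (preimage y))         ∎) ⟩
      lookup u (step G (preimage y))         ≡⟨ commutes u-hom _ ⟩
      step Z (lookup u (preimage y))         ≡⟨ cong (step Z) (sym (VP.lookup∘tabulate _ y)) ⟩
      step Z (lookup (Ψ u) y)                ∎)
    ΨΦ : ∀ w → T (isHom image Z w) → Ψ (Φ w) ≡ w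
    ΨΦ w _ = ≗⇒≡ λ y → trans (VP.lookup∘tabulate _ y)
      (trans (VP.lookup∘tabulate _ (preimage y)) (cong (lookup w) (π-ι (κ-preimage y))))
    ΦΨ : ∀ u → T (above? Z (ker κ) u) → Φ (Ψ u) ≡ u
    ΦΨ u t = ≗⇒≡ λ i → trans (VP.lookup∘tabulate _ i) (trans (VP.lookup∘tabulate _ (π i))
      (ker⊆⇒ κ u (proj₂ (above⇒ u t)) (trans (κ-preimage (π i)) (ι-π i))))

  Kernel↔ : Kernel ↔ Fin (2 ℕ.^ (g * g))
  Kernel↔ = Vec↔ (↔-sym FP.2↔Bool) (g * g)

  private
    decode : Fin (2 ℕ.^ (g * g)) → Kernel
    decode = Inverse.from Kernel↔
    encode : Kernel → Fin (2 ℕ.^ (g * g))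
    encode = Inverse.to Kernel↔

  homsAbove-partition : ∀ Z K → homsAbove Z K ≡ sum (λ b → Bool→ℕ ⌊ K SubsetP.⊆? decode b ⌋ * homsWith Z (decode b))
  homsAbove-partition Z K = trans (count-fibres (above? Z K ∘ v) (encode ∘ ker ∘ v)) (sum-cong-≗ λ b →
    trans (count-cong (fibre b)) (count-∧ˡ ⌊ K SubsetP.⊆? decode b ⌋ (exactly? Z (decode b) ∘ v)))
    where
    v : Fin (size Z ℕ.^ g) → Map G Z
    v = Inverse.from (Map↔ G Z)
    fibre : ∀ b i → (above? Z K (v i) ∧ (encode (ker (v i)) ≡ᵇ b)) ≡ (⌊ K SubsetP.⊆? decode b ⌋ ∧ exactly? Z (decode b) (v i))
    fibre b i = T-⇔⇒≡
      (λ t → let a , e = Equivalence.to (BP.T-∧ {above? Z K (v i)}) t ; v-hom , K⊆ = above⇒ (v i) a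
                 ker≡ = trans (sym (Inverse.strictlyInverseʳ Kernel↔ _)) (cong decode (toWitness e)) in
        Equivalence.from BP.T-∧
          (fromWitness {a? = K SubsetP.⊆? decode b} (λ {x} → subst (x ∈_) ker≡ ∘ K⊆) , ⇒exactly (v i) v-hom ker≡))
      (λ t → let c , e = Equivalence.to (BP.T-∧ {⌊ K SubsetP.⊆? decode b ⌋}) t ; v-hom , ker≡ = exactly⇒ (v i) e in
        Equivalence.from BP.T-∧ (⇒above (v i) v-hom (λ {x} → subst (x ∈_) (sym ker≡) ∘ toWitness c {x}) ,
          fromWitness {a? = encode (ker (v i)) FP.≟ b} (trans (cong encode ker≡) (Inverse.strictlyInverseˡ Kernel↔ b))))

  module _ (X Y : FDDS) (same-counts : ∀ H → homCount H X ≡ homCount H Y) where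

    -- Downward induction on K: if some hom κ has kernel K, then homsAbove Z K is the hom
    -- count from the image of κ, so it is the same for X and Y, and in the partition of
    -- homsAbove Z K all terms with K ⊂ K′ agree by induction; otherwise both counts are 0.
    homsWith-≡ : ∀ K → homsWith X K ≡ homsWith Y K
    homsWith-≡ = All.wfRec SubsetI.⊃-wellFounded 0ℓ _ induction-step
      where
      realized⇒≡ : ∀ K → (∀ {K′} → K ⊂ K′ → homsWith X K′ ≡ homsWith Y K′) →
        ∀ {Z₀} (κ : Map G Z₀) → IsHom G Z₀ κ → ker κ ≡ K → homsWith X K ≡ homsWith Y K
      realized⇒≡ K IH κ κ-hom refl = begin
        homsWith X K         ≡⟨ term-at-K X ⟨
        term X (encode K)    ≡⟨ sum-cancel-except (term X) (term Y) (encode K) above-≡ others ⟩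
        term Y (encode K)    ≡⟨ term-at-K Y ⟩
        homsWith Y K         ∎
        where
        open ≡-Reasoning
        term : FDDS → Fin (2 ℕ.^ (g * g)) → ℕ
        term Z b = Bool→ℕ ⌊ K SubsetP.⊆? decode b ⌋ * homsWith Z (decode b)
        term-at-K : ∀ Z → term Z (encode K) ≡ homsWith Z K
        term-at-K Z = begin
          term Z (encode K)
            ≡⟨ cong (λ K′ → Bool→ℕ ⌊ K SubsetP.⊆? K′ ⌋ * homsWith Z K′) (Inverse.strictlyInverseʳ Kernel↔ K) ⟩
          Bool→ℕ ⌊ K SubsetP.⊆? K ⌋ * homsWith Z K
            ≡⟨ cong (λ c → Bool→ℕ c * homsWith Z K) (trans (isYes≗does (K SubsetP.⊆? K)) (dec-true (K SubsetP.⊆? K) (λ x∈ → x∈))) ⟩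
          1 * homsWith Z K
            ≡⟨ ℕP.*-identityˡ _ ⟩
          homsWith Z K                                    ∎
        above-≡ : sum (term X) ≡ sum (term Y)
        above-≡ = begin
          sum (term X)            ≡⟨ homsAbove-partition X K ⟨
          homsAbove X K           ≡⟨ homsAbove-ker κ κ-hom X ⟩
          homCount (Image.image κ κ-hom) X ≡⟨ same-counts _ ⟩
          homCount (Image.image κ κ-hom) Y ≡⟨ homsAbove-ker κ κ-hom Y ⟨
          homsAbove Y K           ≡⟨ homsAbove-partition Y K ⟩
          sum (term Y)            ∎
        others : ∀ b → b ≢ encode K → term X b ≡ term Y b
        others b b≢K with K SubsetP.⊆? decode b
        ... | yes K⊆ = cong (1 *_) (IH (⊆∧≢⇒⊂ K⊆ λ K≡ →
          b≢K (trans (sym (Inverse.strictlyInverseˡ Kernel↔ b)) (cong encode (sym K≡)))))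
        ... | no  _  = refl
      induction-step : ∀ K → (∀ {K′} → K ⊂ K′ → homsWith X K′ ≡ homsWith Y K′) → homsWith X K ≡ homsWith Y K
      induction-step K IH with 0 ℕ.<? homsWith X K | 0 ℕ.<? homsWith Y K
      ... | yes pos | _       = let κ , κ-hom , ker≡ = homsWith>0⇒ X K pos in realized⇒≡ K IH κ κ-hom ker≡
      ... | no  _   | yes pos = let κ , κ-hom , ker≡ = homsWith>0⇒ Y K pos in realized⇒≡ K IH κ κ-hom ker≡
      ... | no  X≯0 | no  Y≯0 = trans (ℕP.n≤0⇒n≡0 (ℕP.≮⇒≥ X≯0)) (sym (ℕP.n≤0⇒n≡0 (ℕP.≮⇒≥ Y≯0)))

injective⇒surjective : ∀ {n m} (f : Fin n → Fin m) → (∀ {i j} → f i ≡ f j → i ≡ j) → m ≤ n → ∀ y → ∃ λ x → f x ≡ y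
injective⇒surjective {n} {suc m} f f-inj m≤n y with FP.any? (λ x → f x FP.≟ y)
... | yes found = found
... | no  ¬found = ⊥-elim (ℕP.<-irrefl refl (ℕP.≤-trans m≤n (FP.injective⇒≤ f′-inj)))
  where
  y≢f : ∀ x → y ≢ f x
  y≢f x y≡fx = ¬found (x , sym y≡fx)
  f′ : Fin n → Fin m
  f′ x = F.punchOut (y≢f x)
  f′-inj : ∀ {a b} → f′ a ≡ f′ b → a ≡ b
  f′-inj {a} {b} eq = f-inj (FP.punchOut-injective (y≢f a) (y≢f b) eq)

injectiveHom : ∀ X Y → (∀ H → homCount H X ≡ homCount H Y) →
  ∃ λ (v : Map X Y) → IsHom X Y v × (∀ {i j} → lookup v i ≡ lookup v j → i ≡ j)
injectiveHom X Y same-counts =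
  let v , v-hom , ker≡Δ = homsWith>0⇒ Y Δ homsWith-Δ>0 in
  v , v-hom , λ {i} {j} vᵢ≡vⱼ → trans (sym (VP.lookup∘tabulate _ i))
    (trans (ker⊆⇒ v idᵛ (SubsetP.⊆-reflexive ker≡Δ) vᵢ≡vⱼ) (VP.lookup∘tabulate _ j))
  where
  open Kernels X
  idᵛ : Map X X
  idᵛ = tabulate (λ i → i)
  Δ : Kernel
  Δ = ker idᵛ
  homsWith-Δ>0 : 0 < homsWith Y Δ
  homsWith-Δ>0 = subst (0 <_) (homsWith-≡ X Y same-counts Δ) (⇒homsWith>0 X Δ idᵛ (tabulate-hom (homFn λ _ → refl)) refl)

homCount-injective : ∀ X Y → (∀ H → homCount H X ≡ homCount H Y) → X ≅ Y
homCount-injective X Y same-counts with injectiveHom X Y same-counts | injectiveHom Y X (sym ∘ same-counts)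
... | v , v-hom , v-inj | _ , _ , w-inj = record
  { to = lookup v ; from = proj₁ ∘ onto ; from-to = λ x → v-inj (proj₂ (onto (lookup v x)))
  ; to-from = proj₂ ∘ onto ; commute = commutes v-hom }
  where
  onto = injective⇒surjective (lookup v) v-inj (FP.injective⇒≤ w-inj)

-- Homomorphisms to cycles

rotate : ∀ {p} → Fin p → Fin p
rotate {suc q} i = suc (toℕ i) mod suc q

Cycle : ℕ → FDDS
Cycle p = fdds p rotate

module _ {q : ℕ} where
  private
    p = suc q

  suc-%-% : ∀ k → suc (k % p) % p ≡ suc k % p
  suc-%-% k = trans (%-distribˡ-+ 1 (k % p) p) (trans (cong (λ m → (1 % p + m) % p) (m%n%n≡m%n k p)) (sym (%-distribˡ-+ 1 k p)))

  toℕ-rotate^ : ∀ k (i : Fin p) → toℕ (iterate rotate k i) ≡ (toℕ i + k) % p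
  toℕ-rotate^ zero    i = sym (trans (cong (_% p) (ℕP.+-identityʳ (toℕ i))) (m<n⇒m%n≡m (FP.toℕ<n i)))
  toℕ-rotate^ (suc k) i = begin
    toℕ (rotate (iterate rotate k i)) ≡⟨ FP.toℕ-fromℕ< _ ⟩
    suc (toℕ (iterate rotate k i)) % p ≡⟨ cong (λ m → suc m % p) (toℕ-rotate^ k i) ⟩
    suc ((toℕ i + k) % p) % p          ≡⟨ suc-%-% (toℕ i + k) ⟩
    suc (toℕ i + k) % p                ≡⟨ cong (_% p) (sym (ℕP.+-suc (toℕ i) k)) ⟩
    (toℕ i + suc k) % p                ∎
    where open ≡-Reasoning

  rotate^-hom : ∀ k → IsHomFn (Cycle p) (Cycle p) (iterate rotate k)
  rotate^-hom k = homFn λ i → iterate-comm rotate k 1 i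

  rotate^-onto : ∀ (i j : Fin p) → iterate rotate (toℕ j + (p ∸ toℕ i)) i ≡ j
  rotate^-onto i j = FP.toℕ-injective (begin
    toℕ (iterate rotate (toℕ j + (p ∸ toℕ i)) i) ≡⟨ toℕ-rotate^ _ i ⟩
    (toℕ i + (toℕ j + (p ∸ toℕ i))) % p           ≡⟨ cong (_% p) (rearrange (toℕ i) (toℕ j)) ⟩
    (toℕ j + (toℕ i + (p ∸ toℕ i))) % p
      ≡⟨ cong (λ m → (toℕ j + m) % p) (ℕP.m+[n∸m]≡n (ℕP.<⇒≤ (FP.toℕ<n i))) ⟩
    (toℕ j + p) % p                               ≡⟨ [m+n]%n≡m%n (toℕ j) p ⟩
    toℕ j % p                                     ≡⟨ m<n⇒m%n≡m (FP.toℕ<n j) ⟩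
    toℕ j                                         ∎)
    where
    open ≡-Reasoning
    rearrange : ∀ a b → a + (b + (p ∸ a)) ≡ b + (a + (p ∸ a))
    rearrange a b = trans (sym (ℕP.+-assoc a b _)) (trans (cong (_+ (p ∸ a)) (ℕP.+-comm a b)) (ℕP.+-assoc b a _))

  rotate^p : ∀ i → iterate rotate p i ≡ i
  rotate^p i = FP.toℕ-injective (trans (toℕ-rotate^ p i) (trans ([m+n]%n≡m%n (toℕ i) p) (m<n⇒m%n≡m (FP.toℕ<n i))))

  rotate-injective : ∀ {i j : Fin p} → rotate i ≡ rotate j → i ≡ j
  rotate-injective {i} {j} eq = begin
    i                           ≡⟨ sym (rotate^p i) ⟩
    iterate rotate p i          ≡⟨ sym (iterate-comm rotate q 1 i) ⟩
    iterate rotate q (rotate i) ≡⟨ cong (iterate rotate q) eq ⟩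
    iterate rotate q (rotate j) ≡⟨ iterate-comm rotate q 1 j ⟩
    iterate rotate p j          ≡⟨ rotate^p j ⟩
    j                           ∎
    where open ≡-Reasoning

rotate-no-fixed-point : ∀ {q} → 1 ≤ q → (i : Fin (suc q)) → rotate i ≢ i
rotate-no-fixed-point {q} 1≤q i fixed with ℕP.m≤n⇒m<n∨m≡n (ℕP.≤-pred (FP.toℕ<n i))
... | inj₁ i<q = ℕP.1+n≢n (trans (sym (m<n⇒m%n≡m (s≤s i<q))) (trans (sym (FP.toℕ-fromℕ< _)) (cong toℕ fixed)))
... | inj₂ i≡q = ℕP.<-irrefl (sym q≡0) (ℕP.<-≤-trans (s≤s z≤n) 1≤q)
  where
  q≡0 : q ≡ 0
  q≡0 = begin
    q                   ≡⟨ sym i≡q ⟩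
    toℕ i               ≡⟨ cong toℕ (sym fixed) ⟩
    toℕ (rotate i)      ≡⟨ FP.toℕ-fromℕ< _ ⟩
    suc (toℕ i) % suc q ≡⟨ cong (λ m → suc m % suc q) i≡q ⟩
    suc q % suc q       ≡⟨ n%n≡0 (suc q) ⟩
    0                   ∎
    where open ≡-Reasoning

hom-determined : ∀ {G Z} → Connected G → (∀ {a b} → step Z a ≡ step Z b → a ≡ b) →
  ∀ u w → IsHom G Z u → IsHom G Z w → ∀ x → lookup u x ≡ lookup w x → u ≡ w
hom-determined {G} {Z} G-conn step-inj u w u-hom w-hom x agree-x = ≗⇒≡ λ y →
  toWitness (subst T (connected-const G agree? agree?-step G-conn x y) (fromWitness agree-x))
  where
  agree? : Fin (size G) → Bool
  agree? y = ⌊ lookup u y FP.≟ lookup w y ⌋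
  agree?-step : ∀ y → agree? (step G y) ≡ agree? y
  agree?-step y = T-⇔⇒≡
    (λ t → fromWitness (step-inj (trans (sym (commutes u-hom y)) (trans (toWitness t) (commutes w-hom y)))))
    (λ t → fromWitness (trans (commutes u-hom y) (trans (cong (step Z) (toWitness t)) (sym (commutes w-hom y)))))

homCount-Cycle : ∀ G {q} → Connected G → ∀ τ → IsHom G (Cycle (suc q)) τ → homCount G (Cycle (suc q)) ≡ suc q
homCount-Cycle G {q} G-conn τ τ-hom = homCount-unique G C (mk↔ₛ′
  (λ (u , _) → lookup u x₀) (λ j → rotated j , toHom (rotated j) (rotated-hom j)) rotated-x₀
  (λ (u , t) → let j = lookup u x₀ in
    Σ-T-≡ (hom-determined G-conn rotate-injective (rotated j) u (rotated-hom j) (fromHom u t) x₀ (rotated-x₀ j))))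
  where
  C = Cycle (suc q)
  x₀ = F.fromℕ< (proj₁ G-conn)
  rotated : Fin (suc q) → Map G C
  rotated j = V.map (iterate rotate (toℕ j + (suc q ∸ toℕ (lookup τ x₀)))) τ
  rotated-hom : ∀ j → IsHom G C (rotated j)
  rotated-hom j = map-hom τ τ-hom (rotate^-hom (toℕ j + (suc q ∸ toℕ (lookup τ x₀))))
  rotated-x₀ : ∀ j → lookup (rotated j) x₀ ≡ j
  rotated-x₀ j = trans (VP.lookup-map x₀ (iterate rotate (toℕ j + (suc q ∸ toℕ (lookup τ x₀)))) τ) (rotate^-onto (lookup τ x₀) j)

module _ {A : Set} (_≟_ : DecidableEquality A) (f : A → A) where

  minimal-period : ∀ {P a} → iterate f (suc P) a ≡ a →
    ∃ λ q → suc q ≤ suc P × iterate f (suc q) a ≡ a × (∀ k → 0 < k → k < suc q → iterate f k a ≢ a)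
  minimal-period {P} {a} periodic
    with FP.¬∀⟶∃¬-smallest (suc P) (λ k → iterate f (suc (toℕ k)) a ≢ a) (λ k → ¬? (iterate f (suc (toℕ k)) a ≟ a))
           (λ none → none (F.fromℕ P) (subst (λ m → iterate f (suc m) a ≡ a) (sym (FP.toℕ-fromℕ P)) periodic))
  ... | i , ¬¬periodic , earlier = toℕ i , FP.toℕ<n i , decidable-stable (_ ≟ a) ¬¬periodic , minimal
    where
    minimal : ∀ k → 0 < k → k < suc (toℕ i) → iterate f k a ≢ a
    minimal (suc k) _ (s≤s k<i) = subst (λ m → iterate f (suc m) a ≢ a) (trans (FP.toℕ-inject j) (FP.toℕ-fromℕ< k<i)) (earlier j)
      where j = F.fromℕ< k<i

  minimal-period-mod : ∀ {q a} → iterate f (suc q) a ≡ a → (∀ k → 0 < k → k < suc q → iterate f k a ≢ a) →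
    ∀ i j → iterate f i a ≡ iterate f j a → i % suc q ≡ j % suc q
  minimal-period-mod {q} {a} periodic minimal i j aᵢ≡aⱼ = equal (m%n<n i p) (m%n<n j p) reduced
    where
    p = suc q
    it = iterate f
    reduced : it (i % p) a ≡ it (j % p) a
    reduced = trans (sym (iterate-mod f periodic i)) (trans aᵢ≡aⱼ (iterate-mod f periodic j))
    distinct : ∀ {r s} → r < s → s < p → it r a ≢ it s a
    distinct {r} {s} r<s s<p aᵣ≡aₛ = minimal (e + r) 0<e+r e+r<p (begin
      it (e + r) a      ≡⟨ iterate-+ f e r a ⟩
      it e (it r a)     ≡⟨ cong (it e) aᵣ≡aₛ ⟩
      it e (it s a)     ≡⟨ sym (iterate-+ f e s a) ⟩
      it (e + s) a      ≡⟨ cong (λ m → it m a) e+s≡p ⟩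
      it p a            ≡⟨ periodic ⟩
      a                 ∎)
      where
      open ≡-Reasoning
      e = proj₁ (ℕP.m≤n⇒∃[o]m+o≡n (ℕP.<⇒≤ s<p))
      e+s≡p : e + s ≡ p
      e+s≡p = trans (ℕP.+-comm e s) (proj₂ (ℕP.m≤n⇒∃[o]m+o≡n (ℕP.<⇒≤ s<p)))
      0<e+r : 0 < e + r
      0<e : 0 < e
      0<e = ℕP.+-cancelˡ-< s 0 e (subst₂ _<_ (sym (ℕP.+-identityʳ s)) (sym (trans (ℕP.+-comm s e) e+s≡p)) s<p)
      0<e+r = ℕP.<-≤-trans 0<e (ℕP.m≤m+n e r)
      e+r<p : e + r < p
      e+r<p = subst (e + r <_) e+s≡p (ℕP.+-monoʳ-< e r<s)
    equal : ∀ {r s} → r < p → s < p → it r a ≡ it s a → r ≡ s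
    equal {r} {s} r<p s<p aᵣ≡aₛ with ℕP.<-cmp r s
    ... | tri< r<s _ _ = ⊥-elim (distinct r<s s<p aᵣ≡aₛ)
    ... | tri≈ _ r≡s _ = r≡s
    ... | tri> _ _ s<r = ⊥-elim (distinct s<r r<p (sym aᵣ≡aₛ))

periodic⇒period≤size : ∀ A {P x} → iterate (step A) (suc P) x ≡ x →
  ∃ λ q → suc q ≤ size A × iterate (step A) (suc q) x ≡ x
periodic⇒period≤size A {P} {x} periodic with eventually-periodic A (iterate (step A) (size A * suc P ∸ size A) x)
... | q , q<n , y-periodic = q , q<n , subst (λ z → iterate (step A) (suc q) z ≡ z) n-steps-of-y y-periodic
  where
  n = size A
  it = iterate (step A)
  n-steps-of-y : it n (it (n * suc P ∸ n) x) ≡ x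
  n-steps-of-y = begin
    it n (it (n * suc P ∸ n) x) ≡⟨ sym (iterate-+ (step A) n (n * suc P ∸ n) x) ⟩
    it (n + (n * suc P ∸ n)) x  ≡⟨ cong (λ m → it m x) (ℕP.m+[n∸m]≡n (ℕP.m≤m*n n (suc P))) ⟩
    it (n * suc P) x        ≡⟨ iterate-periodic (step A) periodic n ⟩
    x                       ∎
    where open ≡-Reasoning

-- The orbit of any x joins that of x₀ after some time, position x; mapped to A the
-- joint orbit runs around the cycle of a, so position x modulo the minimal period of a
-- is a hom from G to the cycle of that length.
module CyclePosition {G A : FDDS} (G-conn : Connected G) (v : Map G A) (v-hom : IsHom G A v) where
  private
    n = size G
    it = iterate (step G)
    itᴬ = iterate (step A)
    x₀ = F.fromℕ< (proj₁ G-conn)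
    open Component G x₀ using (meets⇒; connected⇒meets)

  a : Fin (size A)
  a = lookup v (it n x₀)

  a-periodic : ∃ λ P → itᴬ (suc P) a ≡ a
  a-periodic = let P , _ , periodic = eventually-periodic G x₀ in
    P , trans (sym (hom-iterate v-hom (suc P) (it n x₀))) (cong (lookup v) periodic)

  position : Fin n → ℕ
  position x = proj₁ (meets⇒ (connected⇒meets G-conn x))

  private
    position-spec : ∀ x → it n x ≡ it (n + position x) x₀
    position-spec x = proj₂ (meets⇒ (connected⇒meets G-conn x))

    image-orbit : ∀ k → lookup v (it (n + k) x₀) ≡ itᴬ k a
    image-orbit k = begin
      lookup v (it (n + k) x₀)  ≡⟨ cong (λ m → lookup v (it m x₀)) (ℕP.+-comm n k) ⟩
      lookup v (it (k + n) x₀)  ≡⟨ cong (lookup v) (iterate-+ (step G) k n x₀) ⟩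
      lookup v (it k (it n x₀)) ≡⟨ hom-iterate v-hom k _ ⟩
      itᴬ k a                   ∎
      where open ≡-Reasoning

  position-step : ∀ x → itᴬ (position (step G x)) a ≡ itᴬ (suc (position x)) a
  position-step x = begin
    itᴬ (position (step G x)) a                ≡⟨ sym (image-orbit _) ⟩
    lookup v (it (n + position (step G x)) x₀) ≡⟨ cong (lookup v) (sym (position-spec (step G x))) ⟩
    lookup v (it n (step G x))                 ≡⟨ cong (lookup v) (iterate-comm (step G) n 1 x) ⟩
    lookup v (step G (it n x))                 ≡⟨ cong (lookup v ∘ step G) (position-spec x) ⟩
    lookup v (it (suc (n + position x)) x₀)    ≡⟨ cong (λ m → lookup v (it m x₀)) (sym (ℕP.+-suc n _)) ⟩
    lookup v (it (n + suc (position x)) x₀)    ≡⟨ image-orbit _ ⟩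
    itᴬ (suc (position x)) a                   ∎
    where open ≡-Reasoning

  toCycle : ∀ {q} → itᴬ (suc q) a ≡ a → (∀ k → 0 < k → k < suc q → itᴬ k a ≢ a) →
    IsHom G (Cycle (suc q)) (tabulate (λ x → iterate rotate (position x) zero))
  toCycle {q} periodic minimal = tabulate-hom (homFn λ x → FP.toℕ-injective (begin
    toℕ (iterate rotate (position (step G x)) zero) ≡⟨ toℕ-rotate^ (position (step G x)) zero ⟩
    position (step G x) % suc q
      ≡⟨ minimal-period-mod FP._≟_ (step A) periodic minimal (position (step G x)) (suc (position x)) (position-step x) ⟩
    suc (position x) % suc q                        ≡⟨ sym (toℕ-rotate^ (suc (position x)) zero) ⟩
    toℕ (iterate rotate (suc (position x)) zero)    ∎))
    where open ≡-Reasoning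

hom-into-fixedPointFree⇒cycle : ∀ G A → Connected G → ∀ v → IsHom G A v → (∀ a → step A a ≢ a) →
  ∃ λ q → 1 ≤ q × suc q ≤ size A × homCount G (Cycle (suc q)) ≡ suc q
hom-into-fixedPointFree⇒cycle G A G-conn v v-hom no-fixed =
  let P , P<size , P-periodic = periodic⇒period≤size A {proj₁ a-periodic} (proj₂ a-periodic)
  in from-minimal P<size (minimal-period FP._≟_ (step A) P-periodic)
  where
  open CyclePosition G-conn v v-hom
  from-minimal : ∀ {P} → suc P ≤ size A →
    (∃ λ q → suc q ≤ suc P × iterate (step A) (suc q) a ≡ a × (∀ k → 0 < k → k < suc q → iterate (step A) k a ≢ a)) →
    ∃ λ q → 1 ≤ q × suc q ≤ size A × homCount G (Cycle (suc q)) ≡ suc q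
  from-minimal _      (zero  , _    , fixed    , _)       = ⊥-elim (no-fixed a fixed)
  from-minimal P<size (suc q , q≤P , periodic , minimal) = suc q , s≤s z≤n , ℕP.≤-trans q≤P P<size ,
    homCount-Cycle G G-conn (tabulate (λ x → iterate rotate (position x) zero)) (toCycle periodic minimal)

-- Injectivity of polynomials

polyFrom-mono : ∀ {k} i (cs : Vec ℕ k) {x y} → x ≤ y → polyFrom i cs x ≤ polyFrom i cs y
polyFrom-mono i []       x≤y = z≤n
polyFrom-mono i (c ∷ cs) x≤y = ℕP.+-mono-≤ (ℕP.*-monoʳ-≤ c (ℕP.^-monoˡ-≤ i x≤y)) (polyFrom-mono (suc i) cs x≤y)

polyFrom-strict : ∀ {k} i (cs : Vec ℕ k) {x y} → x < y → ∀ j → 0 < lookup cs j → 0 < i + toℕ j → polyFrom i cs x < polyFrom i cs y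
polyFrom-strict i (c ∷ cs) x<y zero    c>0 i>0 =
  ℕP.+-mono-<-≤ (term-strict c>0 (subst (0 <_) (ℕP.+-identityʳ i) i>0)) (polyFrom-mono (suc i) cs (ℕP.<⇒≤ x<y))
  where
  term-strict : ∀ {c e} → 0 < c → 0 < e → c * _ ℕ.^ e < c * _ ℕ.^ e
  term-strict {suc c} {suc e} _ _ = ℕP.*-monoʳ-< (suc c) (ℕP.^-monoˡ-< (suc e) x<y)
polyFrom-strict i (c ∷ cs) x<y (suc j) cⱼ>0 _   =
  ℕP.+-mono-≤-< (ℕP.*-monoʳ-≤ c (ℕP.^-monoˡ-≤ i (ℕP.<⇒≤ x<y))) (polyFrom-strict (suc i) cs x<y j cⱼ>0 (s≤s z≤n))

polyFrom-injective : ∀ {k} i (cs : Vec ℕ k) j → 0 < lookup cs j → 0 < i + toℕ j →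
  ∀ {x y} → polyFrom i cs x ≡ polyFrom i cs y → x ≡ y
polyFrom-injective i cs j cⱼ>0 i+j>0 {x} {y} eq with ℕP.<-cmp x y
... | tri< x<y _ _ = ⊥-elim (ℕP.<-irrefl eq (polyFrom-strict i cs x<y j cⱼ>0 i+j>0))
... | tri≈ _ x≡y _ = x≡y
... | tri> _ _ y<x = ⊥-elim (ℕP.<-irrefl (sym eq) (polyFrom-strict i cs y<x j cⱼ>0 i+j>0))

polyFrom-zero : ∀ {k} i (cs : Vec ℕ k) x → (∀ j → lookup cs j ≡ 0) → polyFrom i cs x ≡ 0
polyFrom-zero i []       x all-zero = refl
polyFrom-zero i (c ∷ cs) x all-zero rewrite all-zero zero = polyFrom-zero (suc i) cs x (all-zero ∘ suc)

homCount-eval : ∀ C → Connected C → ∀ {k} (As : Vec FDDS k) Z → homCount C (eval As Z) ≡ polyFrom 0 (V.map (homCount C) As) (homCount C Z)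
homCount-eval C C-conn = homCount-evalFrom C C-conn 0

dendron⇒injective : ∀ {k} (As : Vec FDDS k) i → toℕ i > 0 → ContainsDendron (lookup As i) → Injective As
dendron⇒injective As i i>0 dendron X Y P[X]≅P[Y] = homCount-injective X Y (homCount-determined-by-connected X Y same-counts)
  where
  same-counts : ∀ C → Connected C → homCount C X ≡ homCount C Y
  same-counts C C-conn = polyFrom-injective 0 (V.map (homCount C) As) i
    (subst (0 <_) (sym (VP.lookup-map i (homCount C) As)) (fixedPoint⇒homCount>0 C _ (proj₂ (ContainsDendron⇒fixedPoint _ dendron))))
    i>0
    (trans (sym (homCount-eval C C-conn As X)) (trans (homCount-≅ʳ C P[X]≅P[Y]) (homCount-eval C C-conn As Y)))

copies : ℕ → FDDS → FDDS
copies zero    X = 𝟘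
copies (suc n) X = X ⊕ copies n X

homCount-copies : ∀ C → Connected C → ∀ n X → homCount C (copies n X) ≡ n * homCount C X
homCount-copies C C-conn zero    X = homCount-𝟘ʳ C (proj₁ C-conn)
homCount-copies C C-conn (suc n) X = trans (homCount-⊕ʳ C X (copies n X) C-conn) (cong (homCount C X +_) (homCount-copies C C-conn n X))

-- From a connected C, X[ N ] and Y[ N ] have the same hom count as soon as C maps onto
-- a cycle of length 2 + k with k < N: at that level the cycle term is as large as the
-- number of copies, which makes the recursion symmetric in X and Y.
X[_] : ℕ → FDDS
Y[_] : ℕ → FDDS
X[ zero  ] = 𝟙
X[ suc N ] = copies (2 + N) X[ N ] ⊕ Cycle (2 + N) ⊗ Y[ N ]
Y[ zero  ] = 𝟘
Y[ suc N ] = copies (2 + N) Y[ N ] ⊕ Cycle (2 + N) ⊗ X[ N ]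

module _ (C : FDDS) (C-conn : Connected C) (N : ℕ) where
  private
    x = homCount C X[ N ]
    y = homCount C Y[ N ]
    c = homCount C (Cycle (2 + N))

  homCount-X[suc] : homCount C X[ suc N ] ≡ (2 + N) * x + c * y
  homCount-X[suc] = trans (homCount-⊕ʳ C _ _ C-conn)
    (cong₂ _+_ (homCount-copies C C-conn (2 + N) X[ N ]) (homCount-⊗ʳ C (Cycle (2 + N)) Y[ N ]))

  homCount-Y[suc] : homCount C Y[ suc N ] ≡ (2 + N) * y + c * x
  homCount-Y[suc] = trans (homCount-⊕ʳ C _ _ C-conn)
    (cong₂ _+_ (homCount-copies C C-conn (2 + N) Y[ N ]) (homCount-⊗ʳ C (Cycle (2 + N)) X[ N ]))

homCount-X≡Y : ∀ C → Connected C → ∀ N q → 1 ≤ q → q ≤ N → homCount C (Cycle (suc q)) ≡ suc q →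
  homCount C X[ N ] ≡ homCount C Y[ N ]
homCount-X≡Y C C-conn zero    (suc q) 1≤q () cycle-count
homCount-X≡Y C C-conn (suc N) q 1≤q q≤N+1 cycle-count with q ℕ.≟ suc N
... | yes refl = begin
  homCount C X[ suc N ]                ≡⟨ homCount-X[suc] C C-conn N ⟩
  (2 + N) * x + homCount C (Cycle (2 + N)) * y ≡⟨ cong (λ c → (2 + N) * x + c * y) cycle-count ⟩
  (2 + N) * x + (2 + N) * y            ≡⟨ ℕP.+-comm ((2 + N) * x) ((2 + N) * y) ⟩
  (2 + N) * y + (2 + N) * x            ≡⟨ cong (λ c → (2 + N) * y + c * x) cycle-count ⟨
  (2 + N) * y + homCount C (Cycle (2 + N)) * x ≡⟨ homCount-Y[suc] C C-conn N ⟨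
  homCount C Y[ suc N ]                ∎
  where
  open ≡-Reasoning
  x = homCount C X[ N ]
  y = homCount C Y[ N ]
... | no q≢N+1 = begin
  homCount C X[ suc N ]                ≡⟨ homCount-X[suc] C C-conn N ⟩
  (2 + N) * x + homCount C (Cycle (2 + N)) * y ≡⟨ cong₂ (λ x y → (2 + N) * x + homCount C (Cycle (2 + N)) * y) x≡y (sym x≡y) ⟩
  (2 + N) * y + homCount C (Cycle (2 + N)) * x ≡⟨ homCount-Y[suc] C C-conn N ⟨
  homCount C Y[ suc N ]                ∎
  where
  open ≡-Reasoning
  x = homCount C X[ N ]
  y = homCount C Y[ N ]
  x≡y : x ≡ y
  x≡y = homCount-X≡Y C C-conn N q 1≤q (ℕP.≤-pred (ℕP.≤∧≢⇒< q≤N+1 q≢N+1)) cycle-count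

𝟙-connected : Connected 𝟙
𝟙-connected = s≤s z≤n , λ { zero zero → EC.reflexive (Arc 𝟙) }

X-has-fixed-point : ∀ N → 0 < homCount 𝟙 X[ N ]
Y-has-no-fixed-point : ∀ N → homCount 𝟙 Y[ N ] ≡ 0
X-has-fixed-point zero    = fixedPoint⇒homCount>0 𝟙 𝟙 {zero} refl
X-has-fixed-point (suc N) = subst (0 <_) (sym (homCount-X[suc] 𝟙 𝟙-connected N))
  (ℕP.<-≤-trans (X-has-fixed-point N) (ℕP.≤-trans (ℕP.m≤m+n _ _) (ℕP.m≤m+n _ _)))
Y-has-no-fixed-point zero    = homCount-𝟘ʳ 𝟙 (s≤s z≤n)
Y-has-no-fixed-point (suc N) = begin
  homCount 𝟙 Y[ suc N ]                                              ≡⟨ homCount-Y[suc] 𝟙 𝟙-connected N ⟩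
  (2 + N) * homCount 𝟙 Y[ N ] + homCount 𝟙 (Cycle (2 + N)) * homCount 𝟙 X[ N ]
    ≡⟨ cong₂ (λ y c → (2 + N) * y + c * homCount 𝟙 X[ N ]) (Y-has-no-fixed-point N)
             (noFixedPoint⇒homCount≡0 (Cycle (2 + N)) (rotate-no-fixed-point (s≤s z≤n))) ⟩
  (2 + N) * 0 + 0                                                     ≡⟨ ℕP.+-identityʳ _ ⟩
  (2 + N) * 0                                                         ≡⟨ ℕP.*-zeroʳ (2 + N) ⟩
  0                                                                   ∎
  where open ≡-Reasoning

noFixedPoint⇒notInjective : ∀ {m} (A₀ : FDDS) (As : Vec FDDS m) → (∀ j a → step (lookup As j) a ≢ a) →
  ¬ Injective (A₀ ∷ As)
noFixedPoint⇒notInjective A₀ As no-fixed injective = ℕP.<-irrefl (sym (Y-has-no-fixed-point N))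
  (subst (0 <_) (homCount-≅ʳ 𝟙 X≅Y) (X-has-fixed-point N))
  where
  N = sum (λ j → size (lookup As j))
  same-value : ∀ C → Connected C → let cs = V.map (homCount C) As in
    polyFrom 0 (homCount C A₀ ∷ cs) (homCount C X[ N ]) ≡ polyFrom 0 (homCount C A₀ ∷ cs) (homCount C Y[ N ])
  same-value C C-conn with FP.any? (λ j → 0 ℕ.<? homCount C (lookup As j))
  ... | yes (j , pos) =
    let v , v-hom = homCount>0⇒hom C (lookup As j) pos
        q , 1≤q , q<size , cycle-count = hom-into-fixedPointFree⇒cycle C (lookup As j) C-conn v v-hom (no-fixed j)
        q≤N = ℕP.≤-trans (ℕP.n≤1+n q) (ℕP.≤-trans q<size (≤-sum (λ j → size (lookup As j)) j))
    in cong (polyFrom 0 (V.map (homCount C) (A₀ ∷ As))) (homCount-X≡Y C C-conn N q 1≤q q≤N cycle-count)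
  ... | no none = cong (homCount C A₀ * 1 +_) (trans (polyFrom-zero 1 cs _ unreachable) (sym (polyFrom-zero 1 cs _ unreachable)))
    where
    cs = V.map (homCount C) As
    unreachable : ∀ j → lookup (V.map (homCount C) As) j ≡ 0
    unreachable j = trans (VP.lookup-map j (homCount C) As) (ℕP.n≤0⇒n≡0 (ℕP.≮⇒≥ (λ pos → none (j , pos))))
  same-counts : ∀ C → Connected C → homCount C (eval (A₀ ∷ As) X[ N ]) ≡ homCount C (eval (A₀ ∷ As) Y[ N ])
  same-counts C C-conn = trans (homCount-eval C C-conn (A₀ ∷ As) X[ N ])
    (trans (same-value C C-conn) (sym (homCount-eval C C-conn (A₀ ∷ As) Y[ N ])))
  X≅Y : X[ N ] ≅ Y[ N ]
  X≅Y = injective X[ N ] Y[ N ] (homCount-injective _ _ (homCount-determined-by-connected _ _ same-counts))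

injective⇒dendron : ∀ {m} (As : Vec FDDS (suc m)) → Injective As → Σ (Fin (suc m)) (λ i → (toℕ i > 0) × ContainsDendron (lookup As i))
injective⇒dendron (A₀ ∷ As) injective with FP.any? (λ j → FP.any? (λ a → step (lookup As j) a FP.≟ a))
... | yes (j , a , fixed) = suc j , s≤s z≤n , fixedPoint⇒ContainsDendron (lookup As j) fixed
... | no  none            = ⊥-elim (noFixedPoint⇒notInjective A₀ As (λ j a fixed → none (j , a , fixed)) injective)

theorem42 : (m : ℕ) (As : Vec FDDS (suc m)) →
    Injective As ⇔ Σ (Fin (suc m)) (λ i → (toℕ i > 0) × ContainsDendron (lookup As i))
theorem42 m As = mk⇔ (injective⇒dendron As) (λ (i , i>0 , dendron) → dendron⇒injective As i i>0 dendron)
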